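{- The right contraction rule $(ic_r)$: from $\mathcal{G}/\!/\Gamma\vdash A,A,\Delta/\!/\mathcal{H}$ infer $\mathcal{G}/\!/\Gamma\vdash A,\Delta/\!/\mathcal{H}$, is admissible in $\mathsf{LNIF}$: if the premise is derivable in $\mathsf{LNIF}$, so is the conclusion.
   Context: Formulae are first-order over $\bot,\land,\lor,\supset,\forall,\exists$; in sequents bound variables $x,y,\dots$ are distinct from parameters $a,b,\dots$, which occupy all free positions; $A[a/x]$ replaces free occurrences of $x$ by $a$; $p(\vec a)$ is an atomic formula with parameters $\vec a$. A linear nested sequent is $\Gamma_1\vdash\Delta_1 /\!/ \cdots /\!/ \Gamma_n\vdash\Delta_n$ ($n\ge1$), each $\Gamma_i,\Delta_i$ a finite, possibly empty, multiset of formulae (a component). In rule schemas, $\mathcal{G},\mathcal{H},\mathcal{F}$ denote possibly empty sequences of components. $\mathsf{LNIF}$ has the rules (from premise(s) infer conclusion): Initial: $(id_1)$ $\mathcal{G}/\!/\Gamma,p(\vec a)\vdash p(\vec a),\Delta/\!/\mathcal{H}$; $(id_2)$ $\mathcal{G}/\!/\Gamma_1,p(\vec a)\vdash\Delta_1/\!/\mathcal{H}/\!/\Gamma_2\vdash p(\vec a),\Delta_2/\!/\mathcal{F}$; $(\bot_l)$ $\mathcal{G}/\!/\Gamma,\bot\vdash\Delta/\!/\mathcal{H}$. $(\land_l)$: from $\mathcal{G}/\!/\Gamma,A,B\vdash\Delta/\!/\mathcal{H}$ infer $\mathcal{G}/\!/\Gamma,A\land B\vdash\Delta/\!/\mathcal{H}$.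 $(\lor_r)$: from $\mathcal{G}/\!/\Gamma\vdash\Delta,A,B/\!/\mathcal{H}$ infer $\mathcal{G}/\!/\Gamma\vdash\Delta,A\lor B/\!/\mathcal{H}$. $(\land_r)$: from $\mathcal{G}/\!/\Gamma\vdash\Delta,A/\!/\mathcal{H}$ and $\mathcal{G}/\!/\Gamma\vdash\Delta,B/\!/\mathcal{H}$ infer $\mathcal{G}/\!/\Gamma\vdash\Delta,A\land B/\!/\mathcal{H}$. $(\lor_l)$: from $\mathcal{G}/\!/\Gamma,A\vdash\Delta/\!/\mathcal{H}$ and $\mathcal{G}/\!/\Gamma,B\vdash\Delta/\!/\mathcal{H}$ infer $\mathcal{G}/\!/\Gamma,A\lor B\vdash\Delta/\!/\mathcal{H}$. $(\supset_{r1})$: from $\mathcal{G}/\!/\Gamma\vdash\Delta/\!/A\vdash B$ infer $\mathcal{G}/\!/\Gamma\vdash\Delta,A\supset B$. $(\supset_l)$: from $\mathcal{G}/\!/\Gamma,B\vdash\Delta/\!/\mathcal{H}$ and $\mathcal{G}/\!/\Gamma,A\supset B\vdash A,\Delta/\!/\mathcal{H}$ infer $\mathcal{G}/\!/\Gamma,A\supset B\vdash\Delta/\!/\mathcal{H}$. $(lift)$: from $\mathcal{G}/\!/\Gamma_1,A\vdash\Delta_1/\!/\Gamma_2,A\vdash\Delta_2/\!/\mathcal{H}$ infer $\mathcal{G}/\!/\Gamma_1,A\vdash\Delta_1/\!/\Gamma_2\vdash\Delta_2/\!/\mathcal{H}$. $(\forall_l)$: from $\mathcal{G}/\!/\Gamma,A[a/x],\forall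 xA\vdash\Delta/\!/\mathcal{H}$ infer $\mathcal{G}/\!/\Gamma,\forall xA\vdash\Delta/\!/\mathcal{H}$ ($a$ any parameter). $(\forall_{r1})$: from $\mathcal{G}/\!/\Gamma\vdash\Delta/\!/\ \vdash A[a/x]$ infer $\mathcal{G}/\!/\Gamma\vdash\Delta,\forall xA$. $(\exists_l)$: from $\mathcal{G}/\!/\Gamma,A[a/x]\vdash\Delta/\!/\mathcal{H}$ infer $\mathcal{G}/\!/\Gamma,\exists xA\vdash\Delta/\!/\mathcal{H}$. $(\exists_r)$: from $\mathcal{G}/\!/\Gamma\vdash A[a/x],\exists xA,\Delta/\!/\mathcal{H}$ infer $\mathcal{G}/\!/\Gamma\vdash\exists xA,\Delta/\!/\mathcal{H}$ ($a$ any parameter). $(\supset_{r2})$: from $\mathcal{G}/\!/\Gamma_1\vdash\Delta_1/\!/A\vdash B/\!/\Gamma_2\vdash\Delta_2/\!/\mathcal{H}$ and $\mathcal{G}/\!/\Gamma_1\vdash\Delta_1/\!/\Gamma_2\vdash\Delta_2,A\supset B/\!/\mathcal{H}$ infer $\mathcal{G}/\!/\Gamma_1\vdash\Delta_1,A\supset B/\!/\Gamma_2\vdash\Delta_2/\!/\mathcal{H}$. $(\forall_{r2})$: from $\mathcal{G}/\!/\Gamma_1\vdash\Delta_1/\!/\ \vdash A[a/x]/\!/\Gamma_2\vdash\Delta_2/\!/\mathcal{H}$ and $\mathcal{G}/\!/\Gamma_1\vdash\Delta_1/\!/\Gamma_2\vdash\Delta_2,\forall xA/\!/\mathcal{H}$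 infer $\mathcal{G}/\!/\Gamma_1\vdash\Delta_1,\forall xA/\!/\Gamma_2\vdash\Delta_2/\!/\mathcal{H}$. In $(\forall_{r1}),(\exists_l),(\forall_{r2})$, $a$ is an eigenvariable (does not occur in the conclusion). -}

module Defs where

open import Data.Nat using (ℕ; _≡ᵇ_)
open import Data.Bool using (if_then_else_)
open import Data.List using (List; []; _∷_; _++_; [_]; map; concatMap)
open import Data.List.Membership.Propositional using (_∈_; _∉_)
open import Data.List.Relation.Binary.Permutation.Propositional using (_↭_)
open import Data.List.Relation.Binary.Pointwise using (Pointwise)
open import Data.List.Relation.Unary.All using (All)
open import Data.Product using (_×_)

Var : Set
Var = ℕ

Param : Set
Param = ℕ

Pred : Set
Pred = ℕ

data Term : Set where
  var : Var → Term
  par : Param → Term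

data Formula : Set where
  atom  : Pred → List Term → Formula
  ⊥'    : Formula
  _∧'_  : Formula → Formula → Formula
  _∨'_  : Formula → Formula → Formula
  _⊃_   : Formula → Formula → Formula
  ∀'    : Var → Formula → Formula
  ∃'    : Var → Formula → Formula

infixr 9 _∧'_
infixr 8 _∨'_
infixr 7 _⊃_

substT : Term → Var → Param → Term
substT (var y) x a = if x ≡ᵇ y then par a else var y
substT (par b) x a = par b

_[_/_] : Formula → Param → Var → Formula
atom p ts [ a / x ] = atom p (map (λ t → substT t x a) ts)
⊥' [ a / x ] = ⊥'
(A ∧' B) [ a / x ] = (A [ a / x ]) ∧' (B [ a / x ])
(A ∨' B) [ a / x ] = (A [ a / x ]) ∨' (B [ a / x ])
(A ⊃ B) [ a / x ] = (A [ a / x ]) ⊃ (B [ a / x ])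
∀' y A [ a / x ] = if x ≡ᵇ y then ∀' y A else ∀' y (A [ a / x ])
∃' y A [ a / x ] = if x ≡ᵇ y then ∃' y A else ∃' y (A [ a / x ])

paramsT : Term → List Param
paramsT (var _) = []
paramsT (par a) = [ a ]

params : Formula → List Param
params (atom _ ts) = concatMap paramsT ts
params ⊥' = []
params (A ∧' B) = params A ++ params B
params (A ∨' B) = params A ++ params B
params (A ⊃ B) = params A ++ params B
params (∀' _ A) = params A
params (∃' _ A) = params A

ClosedT : List Var → Term → Set
ClosedT bs (var y) = y ∈ bs
ClosedT bs (par _) = ⊤' where open import Data.Unit renaming (⊤ to ⊤')

ClosedUnder : List Var → Formula → Set
ClosedUnder bs (atom _ ts) = All (ClosedT bs) ts
ClosedUnder bs ⊥' = ⊤' where open import Data.Unit renaming (⊤ to ⊤')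
ClosedUnder bs (A ∧' B) = ClosedUnder bs A × ClosedUnder bs B
ClosedUnder bs (A ∨' B) = ClosedUnder bs A × ClosedUnder bs B
ClosedUnder bs (A ⊃ B) = ClosedUnder bs A × ClosedUnder bs B
ClosedUnder bs (∀' y A) = ClosedUnder (y ∷ bs) A
ClosedUnder bs (∃' y A) = ClosedUnder (y ∷ bs) A

Closed : Formula → Set
Closed = ClosedUnder []

-- Components Γ ⊢ Δ (Γ, Δ multisets, represented by lists up to permutation)
record Comp : Set where
  constructor _⊢_
  field
    ante : List Formula
    succ : List Formula

infix 3 _⊢_

-- Linear nested sequents: lists of components; in every rule the sequent has
-- the shape G ++ c ∷ H, hence n ≥ 1 automatically.
LNS : Set
LNS = List Comp

paramsC : Comp → List Param
paramsC (Γ ⊢ Δ) = concatMap params Γ ++ concatMap params Δ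

paramsS : LNS → List Param
paramsS = concatMap paramsC

ClosedC : Comp → Set
ClosedC (Γ ⊢ Δ) = All Closed Γ × All Closed Δ

ClosedS : LNS → Set
ClosedS = All ClosedC

CompEq : Comp → Comp → Set
CompEq (Γ ⊢ Δ) (Γ' ⊢ Δ') = (Γ ↭ Γ') × (Δ ↭ Δ')

_≈S_ : LNS → LNS → Set
_≈S_ = Pointwise CompEq

-- Derivability in LNIF.  The constructor 'mset' identifies sequents whose
-- components agree as multisets (components are multisets in the paper).
data LNIF : LNS → Set where
  mset : ∀ {S S'} → LNIF S → S ≈S S' → LNIF S'
  id₁ : ∀ G Γ Δ H p ts → LNIF (G ++ (atom p ts ∷ Γ ⊢ atom p ts ∷ Δ) ∷ H)
  id₂ : ∀ G Γ₁ Δ₁ H Γ₂ Δ₂ F p ts →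
        LNIF (G ++ (atom p ts ∷ Γ₁ ⊢ Δ₁) ∷ H ++ (Γ₂ ⊢ atom p ts ∷ Δ₂) ∷ F)
  ⊥l : ∀ G Γ Δ H → LNIF (G ++ (⊥' ∷ Γ ⊢ Δ) ∷ H)
  ∧l : ∀ {G Γ Δ H A B} → LNIF (G ++ (A ∷ B ∷ Γ ⊢ Δ) ∷ H) →
       LNIF (G ++ (A ∧' B ∷ Γ ⊢ Δ) ∷ H)
  ∨r : ∀ {G Γ Δ H A B} → LNIF (G ++ (Γ ⊢ A ∷ B ∷ Δ) ∷ H) →
       LNIF (G ++ (Γ ⊢ A ∨' B ∷ Δ) ∷ H)
  ∧r : ∀ {G Γ Δ H A B} → LNIF (G ++ (Γ ⊢ A ∷ Δ) ∷ H) →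
       LNIF (G ++ (Γ ⊢ B ∷ Δ) ∷ H) → LNIF (G ++ (Γ ⊢ A ∧' B ∷ Δ) ∷ H)
  ∨l : ∀ {G Γ Δ H A B} → LNIF (G ++ (A ∷ Γ ⊢ Δ) ∷ H) →
       LNIF (G ++ (B ∷ Γ ⊢ Δ) ∷ H) → LNIF (G ++ (A ∨' B ∷ Γ ⊢ Δ) ∷ H)
  ⊃r₁ : ∀ {G Γ Δ A B} → LNIF (G ++ (Γ ⊢ Δ) ∷ [ [ A ] ⊢ [ B ] ]) →
        LNIF (G ++ [ Γ ⊢ A ⊃ B ∷ Δ ])
  ⊃l : ∀ {G Γ Δ H A B} → LNIF (G ++ (B ∷ Γ ⊢ Δ) ∷ H) →
       LNIF (G ++ (A ⊃ B ∷ Γ ⊢ A ∷ Δ) ∷ H) →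
       LNIF (G ++ (A ⊃ B ∷ Γ ⊢ Δ) ∷ H)
  lift : ∀ {G Γ₁ Δ₁ Γ₂ Δ₂ H A} →
         LNIF (G ++ (A ∷ Γ₁ ⊢ Δ₁) ∷ (A ∷ Γ₂ ⊢ Δ₂) ∷ H) →
         LNIF (G ++ (A ∷ Γ₁ ⊢ Δ₁) ∷ (Γ₂ ⊢ Δ₂) ∷ H)
  ∀l : ∀ {G Γ Δ H x A} (a : Param) →
       LNIF (G ++ (A [ a / x ] ∷ ∀' x A ∷ Γ ⊢ Δ) ∷ H) →
       LNIF (G ++ (∀' x A ∷ Γ ⊢ Δ) ∷ H)
  ∀r₁ : ∀ {G Γ Δ x A} (a : Param) →
        a ∉ paramsS (G ++ [ Γ ⊢ ∀' x A ∷ Δ ]) →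
        LNIF (G ++ (Γ ⊢ Δ) ∷ [ [] ⊢ [ A [ a / x ] ] ]) →
        LNIF (G ++ [ Γ ⊢ ∀' x A ∷ Δ ])
  ∃l : ∀ {G Γ Δ H x A} (a : Param) →
       a ∉ paramsS (G ++ (∃' x A ∷ Γ ⊢ Δ) ∷ H) →
       LNIF (G ++ (A [ a / x ] ∷ Γ ⊢ Δ) ∷ H) →
       LNIF (G ++ (∃' x A ∷ Γ ⊢ Δ) ∷ H)
  ∃r : ∀ {G Γ Δ H x A} (a : Param) →
       LNIF (G ++ (Γ ⊢ A [ a / x ] ∷ ∃' x A ∷ Δ) ∷ H) →
       LNIF (G ++ (Γ ⊢ ∃' x A ∷ Δ) ∷ H)
  ⊃r₂ : ∀ {G Γ₁ Δ₁ Γ₂ Δ₂ H A B} →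
        LNIF (G ++ (Γ₁ ⊢ Δ₁) ∷ ([ A ] ⊢ [ B ]) ∷ (Γ₂ ⊢ Δ₂) ∷ H) →
        LNIF (G ++ (Γ₁ ⊢ Δ₁) ∷ (Γ₂ ⊢ A ⊃ B ∷ Δ₂) ∷ H) →
        LNIF (G ++ (Γ₁ ⊢ A ⊃ B ∷ Δ₁) ∷ (Γ₂ ⊢ Δ₂) ∷ H)
  ∀r₂ : ∀ {G Γ₁ Δ₁ Γ₂ Δ₂ H x A} (a : Param) →
        a ∉ paramsS (G ++ (Γ₁ ⊢ ∀' x A ∷ Δ₁) ∷ (Γ₂ ⊢ Δ₂) ∷ H) →
        LNIF (G ++ (Γ₁ ⊢ Δ₁) ∷ ([] ⊢ [ A [ a / x ] ]) ∷ (Γ₂ ⊢ Δ₂) ∷ H) →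
        LNIF (G ++ (Γ₁ ⊢ Δ₁) ∷ (Γ₂ ⊢ ∀' x A ∷ Δ₂) ∷ H) →
        LNIF (G ++ (Γ₁ ⊢ ∀' x A ∷ Δ₁) ∷ (Γ₂ ⊢ Δ₂) ∷ H)

-- Call a monotone map f on component positions, together with a renaming σ of parameters, a cover
-- of S by T when every antecedent X at position p of S is, after renaming, implied in T by the
-- antecedents of the components up to f p, and every succedent by the succedents of the components
-- from f p on. "Implied" closes presence under the decompositions read off the rules: on the left
-- A ∧ B from A and B, A ∨ B from either disjunct, A ⊃ B from B, ∃x A from an instance; on the right
-- A ∧ B from either conjunct, A ∨ B from both, and A ⊃ B (∀x A) from some component at or after the
-- current one implying A on the left and B on the right (an instance on the right).
--
-- Derivability transfers along covers, by induction on the derivation of S. If the principal formula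
-- is implied by decomposition, T already covers the premises. If it is present in T, the same rule is
-- applied in T, after moving the formula to the right component (forward with lift for a left
-- implication, through later components with ⊃r₂/∀r₂ for a right implication or universal), and
-- the new premises cover the premises in S. Eigenvariables are matched by updating σ. Right
-- contraction is the case of the identity map: it covers the premise by the conclusion, in which each
-- copy of A is present.
module Submission where

open import Defs
open import Data.Bool using (true; false)
open import Data.Empty using (⊥; ⊥-elim)
open import Data.Unit using (⊤; tt)
open import Data.List using (List; []; _∷_; _++_; [_]; map; concatMap; length)
open import Data.List.Extrema.Nat using (max; xs≤max)
open import Data.List.Membership.Propositional using (_∈_; _∉_; lose)
open import Data.List.Membership.Propositional.Properties
  using (∈-++⁺ˡ; ∈-++⁺ʳ; ∈-++⁻; ∈-concatMap⁺; ∈-∃++)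
open import Data.List.Properties using (map-id; map-cong; map-∘; length-++; ++-assoc)
open import Data.List.Relation.Unary.All using (All; []; _∷_; lookup)
open import Data.List.Relation.Unary.Any using (here; there)
open import Data.List.Relation.Binary.Permutation.Propositional using (_↭_; ↭-refl; ↭-sym)
open import Data.List.Relation.Binary.Permutation.Propositional.Properties using (∈-resp-↭; shift)
import Data.List.Relation.Binary.Pointwise as Pointwise
open Pointwise using (_∷_; Pointwise-length)
open import Data.Nat using (ℕ; zero; suc; pred; _∸_; z≤n; s≤s; _+_; _⊔_; _≤_; _<_; _≟_; _≤?_; _≡ᵇ_)
open import Data.Nat.Properties
  using ( ≤-refl; ≤-trans; ≤-reflexive; <-irrefl; <-≤-trans; ≤-<-trans; <⇒≤; ≰⇒>; ≤-pred
        ; n≤1+n; 1+n≰n; m≤n⇒m≤1+n; m≤m+n; m≤n+m; m<m+n; +-suc; +-comm; +-identityʳ; m+[n∸m]≡n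
        ; n≮0; pred-mono-≤; m≤m⊔n; ⊔-monoʳ-≤; ⊔-pres-<m; m≤n⇒m⊔n≡n; m≥n⇒m⊔n≡m)
open import Data.Product using (∃; _×_; _,_; proj₁; proj₂)
open import Data.Sum using (_⊎_; inj₁; inj₂)
import Data.Sum as Sum
open import Function using (id; _∘_)
open import Relation.Nullary using (yes; no; ¬_)
open import Relation.Binary.PropositionalEquality hiding ([_])

-- Renaming parameters

Renaming : Set
Renaming = Param → Param

renameᵗ : Renaming → Term → Term
renameᵗ σ (var y) = var y
renameᵗ σ (par b) = par (σ b)

_⟪_⟫ : Formula → Renaming → Formula
atom p ts ⟪ σ ⟫ = atom p (map (renameᵗ σ) ts)
⊥' ⟪ σ ⟫ = ⊥'
(A ∧' B) ⟪ σ ⟫ = (A ⟪ σ ⟫) ∧' (B ⟪ σ ⟫)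
(A ∨' B) ⟪ σ ⟫ = (A ⟪ σ ⟫) ∨' (B ⟪ σ ⟫)
(A ⊃ B) ⟪ σ ⟫ = (A ⟪ σ ⟫) ⊃ (B ⟪ σ ⟫)
∀' y A ⟪ σ ⟫ = ∀' y (A ⟪ σ ⟫)
∃' y A ⟪ σ ⟫ = ∃' y (A ⟪ σ ⟫)

renameᵗ-id : ∀ t → renameᵗ id t ≡ t
renameᵗ-id (var y) = refl
renameᵗ-id (par b) = refl

rename-id : ∀ A → A ⟪ id ⟫ ≡ A
rename-id (atom p ts) = cong (atom p) (trans (map-cong renameᵗ-id ts) (map-id ts))
rename-id ⊥' = refl
rename-id (A ∧' B) = cong₂ _∧'_ (rename-id A) (rename-id B)
rename-id (A ∨' B) = cong₂ _∨'_ (rename-id A) (rename-id B)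
rename-id (A ⊃ B) = cong₂ _⊃_ (rename-id A) (rename-id B)
rename-id (∀' y A) = cong (∀' y) (rename-id A)
rename-id (∃' y A) = cong (∃' y) (rename-id A)

renameᵗ-∘ : ∀ σ τ t → renameᵗ τ (renameᵗ σ t) ≡ renameᵗ (τ ∘ σ) t
renameᵗ-∘ σ τ (var y) = refl
renameᵗ-∘ σ τ (par b) = refl

rename-∘ : ∀ σ τ A → (A ⟪ σ ⟫) ⟪ τ ⟫ ≡ A ⟪ τ ∘ σ ⟫
rename-∘ σ τ (atom p ts) = cong (atom p) (trans (sym (map-∘ ts)) (map-cong (renameᵗ-∘ σ τ) ts))
rename-∘ σ τ ⊥' = refl
rename-∘ σ τ (A ∧' B) = cong₂ _∧'_ (rename-∘ σ τ A) (rename-∘ σ τ B)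
rename-∘ σ τ (A ∨' B) = cong₂ _∨'_ (rename-∘ σ τ A) (rename-∘ σ τ B)
rename-∘ σ τ (A ⊃ B) = cong₂ _⊃_ (rename-∘ σ τ A) (rename-∘ σ τ B)
rename-∘ σ τ (∀' y A) = cong (∀' y) (rename-∘ σ τ A)
rename-∘ σ τ (∃' y A) = cong (∃' y) (rename-∘ σ τ A)

renameᵗ-substT : ∀ σ x a t → renameᵗ σ (substT t x a) ≡ substT (renameᵗ σ t) x (σ a)
renameᵗ-substT σ x a (var y) with x ≡ᵇ y
... | true = refl
... | false = refl
renameᵗ-substT σ x a (par b) = refl

rename-subst : ∀ σ A a x → (A [ a / x ]) ⟪ σ ⟫ ≡ (A ⟪ σ ⟫) [ σ a / x ]
rename-subst σ (atom p ts) a x = cong (atom p) (begin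
  map (renameᵗ σ) (map (λ t → substT t x a) ts)       ≡⟨ map-∘ ts ⟨
  map (λ t → renameᵗ σ (substT t x a)) ts             ≡⟨ map-cong (renameᵗ-substT σ x a) ts ⟩
  map (λ t → substT (renameᵗ σ t) x (σ a)) ts         ≡⟨ map-∘ ts ⟩
  map (λ t → substT t x (σ a)) (map (renameᵗ σ) ts)   ∎)
  where open ≡-Reasoning
rename-subst σ ⊥' a x = refl
rename-subst σ (A ∧' B) a x = cong₂ _∧'_ (rename-subst σ A a x) (rename-subst σ B a x)
rename-subst σ (A ∨' B) a x = cong₂ _∨'_ (rename-subst σ A a x) (rename-subst σ B a x)
rename-subst σ (A ⊃ B) a x = cong₂ _⊃_ (rename-subst σ A a x) (rename-subst σ B a x)
rename-subst σ (∀' y A) a x with x ≡ᵇ y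
... | true = refl
... | false = cong (∀' y) (rename-subst σ A a x)
rename-subst σ (∃' y A) a x with x ≡ᵇ y
... | true = refl
... | false = cong (∃' y) (rename-subst σ A a x)

_[_↦_] : Renaming → Param → Param → Renaming
(σ [ a ↦ t ]) b with b ≟ a
... | yes _ = t
... | no _ = σ b

update-≡ : ∀ σ a t → (σ [ a ↦ t ]) a ≡ t
update-≡ σ a t with a ≟ a
... | yes _ = refl
... | no a≢a = ⊥-elim (a≢a refl)

update-≢ : ∀ σ {a b} t → ¬ b ≡ a → (σ [ a ↦ t ]) b ≡ σ b
update-≢ σ {a} {b} t b≢a with b ≟ a
... | yes b≡a = ⊥-elim (b≢a b≡a)
... | no _ = refl

renameᵗ-update : ∀ σ {a} t {u} → a ∉ paramsT u → renameᵗ (σ [ a ↦ t ]) u ≡ renameᵗ σ u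
renameᵗ-update σ t {var y} a∉u = refl
renameᵗ-update σ t {par b} a∉u = cong par (update-≢ σ t (λ b≡a → a∉u (here (sym b≡a))))

∉-++ˡ : ∀ {a : Param} {xs ys} → a ∉ xs ++ ys → a ∉ xs
∉-++ˡ a∉ = a∉ ∘ ∈-++⁺ˡ

∉-++ʳ : ∀ {a : Param} xs {ys} → a ∉ xs ++ ys → a ∉ ys
∉-++ʳ xs a∉ = a∉ ∘ ∈-++⁺ʳ xs

rename-update : ∀ σ {a} t A → a ∉ params A → A ⟪ σ [ a ↦ t ] ⟫ ≡ A ⟪ σ ⟫
rename-update σ {a} t (atom p ts) a∉ = cong (atom p) (map-update ts a∉)
  where
  map-update : ∀ us → a ∉ concatMap paramsT us → map (renameᵗ (σ [ a ↦ t ])) us ≡ map (renameᵗ σ) us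
  map-update [] _ = refl
  map-update (u ∷ us) a∉ = cong₂ _∷_ (renameᵗ-update σ t (∉-++ˡ a∉)) (map-update us (∉-++ʳ (paramsT u) a∉))
rename-update σ t ⊥' a∉ = refl
rename-update σ t (A ∧' B) a∉ =
  cong₂ _∧'_ (rename-update σ t A (∉-++ˡ a∉)) (rename-update σ t B (∉-++ʳ (params A) a∉))
rename-update σ t (A ∨' B) a∉ =
  cong₂ _∨'_ (rename-update σ t A (∉-++ˡ a∉)) (rename-update σ t B (∉-++ʳ (params A) a∉))
rename-update σ t (A ⊃ B) a∉ =
  cong₂ _⊃_ (rename-update σ t A (∉-++ˡ a∉)) (rename-update σ t B (∉-++ʳ (params A) a∉))
rename-update σ t (∀' y A) a∉ = cong (∀' y) (rename-update σ t A a∉)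
rename-update σ t (∃' y A) a∉ = cong (∃' y) (rename-update σ t A a∉)

rename-eigenvariable : ∀ σ {a} t A x → a ∉ params A →
  (A [ a / x ]) ⟪ σ [ a ↦ t ] ⟫ ≡ (A ⟪ σ ⟫) [ t / x ]
rename-eigenvariable σ {a} t A x a∉A = begin
  (A [ a / x ]) ⟪ σ [ a ↦ t ] ⟫
    ≡⟨ rename-subst (σ [ a ↦ t ]) A a x ⟩
  (A ⟪ σ [ a ↦ t ] ⟫) [ (σ [ a ↦ t ]) a / x ]
    ≡⟨ cong₂ (λ B u → B [ u / x ]) (rename-update σ t A a∉A) (update-≡ σ a t) ⟩
  (A ⟪ σ ⟫) [ t / x ]
    ∎
  where open ≡-Reasoning

fresh : (ps : List Param) → ∃ (_∉ ps)
fresh ps = suc (max 0 ps) , λ p∈ps → 1+n≰n (lookup (xs≤max 0 ps) p∈ps)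

Side : Set
Side = Comp → List Formula

Occurs : Side → LNS → ℕ → Formula → Set
Occurs s [] j X = ⊥
Occurs s (c ∷ S) zero X = X ∈ s c
Occurs s (c ∷ S) (suc j) X = Occurs s S j X

Occursˡ Occursʳ : LNS → ℕ → Formula → Set
Occursˡ = Occurs Comp.ante
Occursʳ = Occurs Comp.succ

occurs-< : ∀ {s} S {j X} → Occurs s S j X → j < length S
occurs-< (c ∷ S) {zero} _ = s≤s z≤n
occurs-< (c ∷ S) {suc j} x∈ = s≤s (occurs-< S x∈)

occurs-here : ∀ {s} G {c H X} → X ∈ s c → Occurs s (G ++ c ∷ H) (length G) X
occurs-here [] x∈ = x∈
occurs-here (d ∷ G) x∈ = occurs-here G x∈

occurs-next : ∀ {s} G {c d H X} → X ∈ s d → Occurs s (G ++ c ∷ d ∷ H) (suc (length G)) X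
occurs-next [] x∈ = x∈
occurs-next (d ∷ G) x∈ = occurs-next G x∈

occurs-after : ∀ {s} G {c H q X} → Occurs s H q X → Occurs s (G ++ c ∷ H) (length G + suc q) X
occurs-after [] x∈ = x∈
occurs-after (d ∷ G) x∈ = occurs-after G x∈

occurs-before : ∀ {s} G R {p X} → Occurs s G p X → Occurs s (G ++ R) p X
occurs-before (c ∷ G) R {zero} x∈ = x∈
occurs-before (c ∷ G) R {suc p} x∈ = occurs-before G R x∈

data Located (s : Side) (G : LNS) (c : Comp) (H : LNS) : ℕ → Formula → Set where
  before : ∀ {p X} → p < length G → Occurs s G p X → Located s G c H p X
  at     : ∀ {X} → X ∈ s c → Located s G c H (length G) X
  after  : ∀ {q X} → Occurs s H q X → Located s G c H (length G + suc q) X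

locate : ∀ {s} G {c H p X} → Occurs s (G ++ c ∷ H) p X → Located s G c H p X
locate [] {p = zero} x∈ = at x∈
locate [] {p = suc p} x∈ = after x∈
locate (d ∷ G) {p = zero} x∈ = before (s≤s z≤n) x∈
locate (d ∷ G) {p = suc p} x∈ with locate G x∈
... | before p< x∈′ = before (s≤s p<) x∈′
... | at x∈′ = at x∈′
... | after x∈′ = after x∈′

params-occurs : ∀ {s} → (∀ c {a} → a ∈ concatMap params (s c) → a ∈ paramsC c) →
  ∀ S {p X a} → Occurs s S p X → a ∈ params X → a ∈ paramsS S
params-occurs incl (c ∷ S) {zero} x∈ a∈ = ∈-++⁺ˡ (incl c (∈-concatMap⁺ params (lose x∈ a∈)))
params-occurs incl (c ∷ S) {suc p} x∈ a∈ = ∈-++⁺ʳ (paramsC c) (params-occurs incl S x∈ a∈)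

params-occursˡ : ∀ S {p X a} → Occursˡ S p X → a ∈ params X → a ∈ paramsS S
params-occursˡ = params-occurs (λ _ → ∈-++⁺ˡ)

params-occursʳ : ∀ S {p X a} → Occursʳ S p X → a ∈ params X → a ∈ paramsS S
params-occursʳ = params-occurs (λ (Γ ⊢ _) → ∈-++⁺ʳ (concatMap params Γ))

-- Implied formulas and covers

data Impliedˡ (T : LNS) (j : ℕ) : Formula → Set where
  present : ∀ {j′ X} → j′ ≤ j → Occursˡ T j′ X → Impliedˡ T j X
  ∧⁺  : ∀ {A B} → Impliedˡ T j A → Impliedˡ T j B → Impliedˡ T j (A ∧' B)
  ∨⁺₁ : ∀ {A B} → Impliedˡ T j A → Impliedˡ T j (A ∨' B)
  ∨⁺₂ : ∀ {A B} → Impliedˡ T j B → Impliedˡ T j (A ∨' B)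
  ⊃⁺  : ∀ {A B} → Impliedˡ T j B → Impliedˡ T j (A ⊃ B)
  ∃⁺  : ∀ {x A} t → Impliedˡ T j (A [ t / x ]) → Impliedˡ T j (∃' x A)

data Impliedʳ (T : LNS) (j : ℕ) : Formula → Set where
  present : ∀ {j′ X} → j ≤ j′ → Occursʳ T j′ X → Impliedʳ T j X
  ∧⁺₁ : ∀ {A B} → Impliedʳ T j A → Impliedʳ T j (A ∧' B)
  ∧⁺₂ : ∀ {A B} → Impliedʳ T j B → Impliedʳ T j (A ∧' B)
  ∨⁺  : ∀ {A B} → Impliedʳ T j A → Impliedʳ T j B → Impliedʳ T j (A ∨' B)
  ⊃⁺  : ∀ {j′ A B} → j ≤ j′ → Impliedˡ T j′ A → Impliedʳ T j′ B → Impliedʳ T j (A ⊃ B)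
  ∀⁺  : ∀ {j′ x A} → j ≤ j′ → ∀ t → Impliedʳ T j′ (A [ t / x ]) → Impliedʳ T j (∀' x A)

Impliedˡ-mono : ∀ {T j k X} → j ≤ k → Impliedˡ T j X → Impliedˡ T k X
Impliedˡ-mono j≤k (present j′≤j x∈) = present (≤-trans j′≤j j≤k) x∈
Impliedˡ-mono j≤k (∧⁺ a b) = ∧⁺ (Impliedˡ-mono j≤k a) (Impliedˡ-mono j≤k b)
Impliedˡ-mono j≤k (∨⁺₁ a) = ∨⁺₁ (Impliedˡ-mono j≤k a)
Impliedˡ-mono j≤k (∨⁺₂ b) = ∨⁺₂ (Impliedˡ-mono j≤k b)
Impliedˡ-mono j≤k (⊃⁺ b) = ⊃⁺ (Impliedˡ-mono j≤k b)
Impliedˡ-mono j≤k (∃⁺ t a) = ∃⁺ t (Impliedˡ-mono j≤k a)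

Impliedʳ-antitone : ∀ {T j k X} → k ≤ j → Impliedʳ T j X → Impliedʳ T k X
Impliedʳ-antitone k≤j (present j≤j′ x∈) = present (≤-trans k≤j j≤j′) x∈
Impliedʳ-antitone k≤j (∧⁺₁ a) = ∧⁺₁ (Impliedʳ-antitone k≤j a)
Impliedʳ-antitone k≤j (∧⁺₂ b) = ∧⁺₂ (Impliedʳ-antitone k≤j b)
Impliedʳ-antitone k≤j (∨⁺ a b) = ∨⁺ (Impliedʳ-antitone k≤j a) (Impliedʳ-antitone k≤j b)
Impliedʳ-antitone k≤j (⊃⁺ j≤j′ a b) = ⊃⁺ (≤-trans k≤j j≤j′) a b
Impliedʳ-antitone k≤j (∀⁺ j≤j′ t a) = ∀⁺ (≤-trans k≤j j≤j′) t a

Impliedʳ-< : ∀ {T j X} → Impliedʳ T j X → j < length T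
Impliedʳ-< {T} (present j≤j′ x∈) = ≤-<-trans j≤j′ (occurs-< T x∈)
Impliedʳ-< (∧⁺₁ a) = Impliedʳ-< a
Impliedʳ-< (∧⁺₂ b) = Impliedʳ-< b
Impliedʳ-< (∨⁺ a b) = Impliedʳ-< a
Impliedʳ-< (⊃⁺ j≤j′ a b) = ≤-<-trans j≤j′ (Impliedʳ-< b)
Impliedʳ-< (∀⁺ j≤j′ t a) = ≤-<-trans j≤j′ (Impliedʳ-< a)

record Cover (S T : LNS) (f : ℕ → ℕ) (σ : Renaming) : Set where
  field
    monotone : ∀ {p q} → p ≤ q → f p ≤ f q
    bounded  : ∀ {p} → p < length S → f p < length T
    coverˡ   : ∀ {p X} → Occursˡ S p X → Impliedˡ T (f p) (X ⟪ σ ⟫)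
    coverʳ   : ∀ {p X} → Occursʳ S p X → Impliedʳ T (f p) (X ⟪ σ ⟫)
open Cover

module _ {T U g τ} (C : Cover T U g τ) where

  Impliedˡ-along : ∀ {j X} → Impliedˡ T j X → Impliedˡ U (g j) (X ⟪ τ ⟫)
  Impliedˡ-along (present j′≤j x∈) = Impliedˡ-mono (monotone C j′≤j) (coverˡ C x∈)
  Impliedˡ-along (∧⁺ a b) = ∧⁺ (Impliedˡ-along a) (Impliedˡ-along b)
  Impliedˡ-along (∨⁺₁ a) = ∨⁺₁ (Impliedˡ-along a)
  Impliedˡ-along (∨⁺₂ b) = ∨⁺₂ (Impliedˡ-along b)
  Impliedˡ-along (⊃⁺ b) = ⊃⁺ (Impliedˡ-along b)
  Impliedˡ-along (∃⁺ {x} {A} t a) = ∃⁺ (τ t) (subst (Impliedˡ U _) (rename-subst τ A t x) (Impliedˡ-along a))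

  Impliedʳ-along : ∀ {j X} → Impliedʳ T j X → Impliedʳ U (g j) (X ⟪ τ ⟫)
  Impliedʳ-along (present j≤j′ x∈) = Impliedʳ-antitone (monotone C j≤j′) (coverʳ C x∈)
  Impliedʳ-along (∧⁺₁ a) = ∧⁺₁ (Impliedʳ-along a)
  Impliedʳ-along (∧⁺₂ b) = ∧⁺₂ (Impliedʳ-along b)
  Impliedʳ-along (∨⁺ a b) = ∨⁺ (Impliedʳ-along a) (Impliedʳ-along b)
  Impliedʳ-along (⊃⁺ j≤j′ a b) = ⊃⁺ (monotone C j≤j′) (Impliedˡ-along a) (Impliedʳ-along b)
  Impliedʳ-along (∀⁺ {x = x} {A} j≤j′ t a) =
    ∀⁺ (monotone C j≤j′) (τ t) (subst (Impliedʳ U _) (rename-subst τ A t x) (Impliedʳ-along a))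

infixl 5 _⨾_

_⨾_ : ∀ {S T U f g σ τ} → Cover S T f σ → Cover T U g τ → Cover S U (g ∘ f) (τ ∘ σ)
_⨾_ {σ = σ} {τ} C D = record
  { monotone = monotone D ∘ monotone C
  ; bounded  = bounded D ∘ bounded C
  ; coverˡ   = λ {_} {X} x∈ → subst (Impliedˡ _ _) (rename-∘ σ τ X) (Impliedˡ-along D (coverˡ C x∈))
  ; coverʳ   = λ {_} {X} x∈ → subst (Impliedʳ _ _) (rename-∘ σ τ X) (Impliedʳ-along D (coverʳ C x∈))
  }

Cover-id : ∀ T → Cover T T id id
Cover-id T = record
  { monotone = id
  ; bounded  = id
  ; coverˡ   = λ {_} {X} x∈ → subst (Impliedˡ T _) (sym (rename-id X)) (present ≤-refl x∈)
  ; coverʳ   = λ {_} {X} x∈ → subst (Impliedʳ T _) (sym (rename-id X)) (present ≤-refl x∈)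
  }

≈S-refl : ∀ S → S ≈S S
≈S-refl S = Pointwise.refl (↭-refl , ↭-refl)

≈S-sym : ∀ {S S′} → S ≈S S′ → S′ ≈S S
≈S-sym = Pointwise.symmetric λ (Γ↭ , Δ↭) → ↭-sym Γ↭ , ↭-sym Δ↭

≈S-at : ∀ G H {c c′} → CompEq c c′ → (G ++ c ∷ H) ≈S (G ++ c′ ∷ H)
≈S-at G H c≈c′ = Pointwise.++⁺ (≈S-refl G) (c≈c′ ∷ ≈S-refl H)

occursˡ-resp-≈ : ∀ {S S′ p X} → S ≈S S′ → Occursˡ S p X → Occursˡ S′ p X
occursˡ-resp-≈ {p = zero} (c≈ ∷ _) x∈ = ∈-resp-↭ (proj₁ c≈) x∈
occursˡ-resp-≈ {p = suc p} (_ ∷ S≈) x∈ = occursˡ-resp-≈ S≈ x∈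

occursʳ-resp-≈ : ∀ {S S′ p X} → S ≈S S′ → Occursʳ S p X → Occursʳ S′ p X
occursʳ-resp-≈ {p = zero} (c≈ ∷ _) x∈ = ∈-resp-↭ (proj₂ c≈) x∈
occursʳ-resp-≈ {p = suc p} (_ ∷ S≈) x∈ = occursʳ-resp-≈ S≈ x∈

Cover-≈ : ∀ {S S′ T f σ} → S ≈S S′ → Cover S′ T f σ → Cover S T f σ
Cover-≈ S≈ C = record
  { monotone = monotone C
  ; bounded  = λ p< → bounded C (subst (_ <_) (Pointwise-length S≈) p<)
  ; coverˡ   = coverˡ C ∘ occursˡ-resp-≈ S≈
  ; coverʳ   = coverʳ C ∘ occursʳ-resp-≈ S≈
  }

cover-update : ∀ {S T f σ a} t → a ∉ paramsS S → Cover S T f σ → Cover S T f (σ [ a ↦ t ])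
cover-update {S} {T} {f} {σ} t a∉ C = record
  { monotone = monotone C
  ; bounded  = bounded C
  ; coverˡ   = λ {_} {X} x∈ →
      subst (Impliedˡ T _) (sym (rename-update σ t X (a∉ ∘ params-occursˡ S x∈))) (coverˡ C x∈)
  ; coverʳ   = λ {_} {X} x∈ →
      subst (Impliedʳ T _) (sym (rename-update σ t X (a∉ ∘ params-occursʳ S x∈))) (coverʳ C x∈)
  }

Within : LNS → ℕ → Renaming → Comp → Comp → Set
Within T j σ c′ c =
  (∀ {X} → X ∈ Comp.ante c′ → X ∈ Comp.ante c ⊎ Impliedˡ T j (X ⟪ σ ⟫)) ×
  (∀ {X} → X ∈ Comp.succ c′ → X ∈ Comp.succ c ⊎ Impliedʳ T j (X ⟪ σ ⟫))

occurs-replace : ∀ {s} G {c c′ H} (P : ℕ → Formula → Set) →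
  (∀ {p X} → Occurs s (G ++ c ∷ H) p X → P p X) →
  (∀ {X} → X ∈ s c′ → X ∈ s c ⊎ P (length G) X) →
  ∀ {p X} → Occurs s (G ++ c′ ∷ H) p X → P p X
occurs-replace G {c} {H = H} P old new x∈ with locate G x∈
... | before _ x∈′ = old (occurs-before G (c ∷ H) x∈′)
... | after x∈′ = old (occurs-after G x∈′)
... | at x∈′ with new x∈′
...   | inj₁ x∈c = old (occurs-here G x∈c)
...   | inj₂ px = px

length-middle : ∀ G {R R′ : LNS} → length R ≡ length R′ → length (G ++ R) ≡ length (G ++ R′)
length-middle G R≡R′ = trans (length-++ G) (trans (cong (length G +_) R≡R′) (sym (length-++ G)))

cover-replace : ∀ G {c c′ H T f σ} → Cover (G ++ c ∷ H) T f σ → Within T (f (length G)) σ c′ c →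
  Cover (G ++ c′ ∷ H) T f σ
cover-replace G {c} {c′} {H} {T} {f} {σ} C (newˡ , newʳ) = record
  { monotone = monotone C
  ; bounded  = λ p< → bounded C (subst (_ <_) (length-middle G {c′ ∷ H} {c ∷ H} refl) p<)
  ; coverˡ   = occurs-replace G (λ p X → Impliedˡ T (f p) (X ⟪ σ ⟫)) (coverˡ C) newˡ
  ; coverʳ   = occurs-replace G (λ p X → Impliedʳ T (f p) (X ⟪ σ ⟫)) (coverʳ C) newʳ
  }

length-∷ʳ : ∀ G {c : Comp} → length (G ++ [ c ]) ≡ suc (length G)
length-∷ʳ G = trans (length-++ G) (+-comm (length G) 1)

cover-replace-next : ∀ G {c d d′ H T f σ} → Cover (G ++ c ∷ d ∷ H) T f σ →
  Within T (f (suc (length G))) σ d′ d → Cover (G ++ c ∷ d′ ∷ H) T f σ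
cover-replace-next G {c} {d} {d′} {H} {T} {f} {σ} C w =
  subst Covered (++-assoc G [ c ] (d′ ∷ H))
    (cover-replace (G ++ [ c ]) (subst Covered (sym (++-assoc G [ c ] (d ∷ H))) C)
      (subst (λ k → Within T (f k) σ d′ d) (sym (length-∷ʳ G)) w))
  where
  Covered : LNS → Set
  Covered S = Cover S T f σ

cover-replace₂ : ∀ G {c c′ d d′ H T f σ} → Cover (G ++ c ∷ d ∷ H) T f σ →
  Within T (f (length G)) σ c′ c → Within T (f (suc (length G))) σ d′ d → Cover (G ++ c′ ∷ d′ ∷ H) T f σ
cover-replace₂ G C wc wd = cover-replace G (cover-replace-next G C wd) wc

prepend : ∀ {P : Formula → Set} {Γ₀ Γ} News → All P News → (∀ {X} → X ∈ Γ → X ∈ Γ₀) →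
  ∀ {X} → X ∈ News ++ Γ → X ∈ Γ₀ ⊎ P X
prepend News ps incl x∈ with ∈-++⁻ News x∈
... | inj₁ x∈News = inj₂ (lookup ps x∈News)
... | inj₂ x∈Γ = inj₁ (incl x∈Γ)

Weakening : LNS → ℕ → Comp → Comp → Set
Weakening T j c c′ =
  (∀ {X} → X ∈ Comp.ante c → X ∈ Comp.ante c′ ⊎ Impliedˡ T j X) ×
  (∀ {X} → X ∈ Comp.succ c → X ∈ Comp.succ c′ ⊎ Impliedʳ T j X)

Weakening⇒Within : ∀ {T j c c′} → Weakening T j c c′ → Within T j id c c′
Weakening⇒Within {T} {j} (newˡ , newʳ) =
  Sum.map₂ (subst (Impliedˡ T j) (sym (rename-id _))) ∘ newˡ ,
  Sum.map₂ (subst (Impliedʳ T j) (sym (rename-id _))) ∘ newʳ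

cover-weaken : ∀ G {c c′ H} → Weakening (G ++ c′ ∷ H) (length G) c c′ → Cover (G ++ c ∷ H) (G ++ c′ ∷ H) id id
cover-weaken G w = cover-replace G (Cover-id _) (Weakening⇒Within w)

cover-weaken₂ : ∀ G {c c′ d d′ H} → Weakening (G ++ c′ ∷ d′ ∷ H) (length G) c c′ →
  Weakening (G ++ c′ ∷ d′ ∷ H) (suc (length G)) d d′ → Cover (G ++ c ∷ d ∷ H) (G ++ c′ ∷ d′ ∷ H) id id
cover-weaken₂ G wc wd = cover-replace₂ G (Cover-id _) (Weakening⇒Within wc) (Weakening⇒Within wd)

Implied : LNS → ℕ → Renaming → Comp → Set
Implied T j σ N =
  (∀ {X} → X ∈ Comp.ante N → Impliedˡ T j (X ⟪ σ ⟫)) ×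
  (∀ {X} → X ∈ Comp.succ N → Impliedʳ T j (X ⟪ σ ⟫))

+suc≰ : ∀ k q → ¬ (k + suc q ≤ k)
+suc≰ k q k+suc≤k = 1+n≰n (≤-trans (s≤s (m≤m+n k q)) (subst (_≤ k) (+-suc k q) k+suc≤k))

suc≤+suc : ∀ k q → suc k ≤ k + suc q
suc≤+suc k q = subst (suc k ≤_) (sym (+-suc k q)) (s≤s (m≤m+n k q))

length-G< : ∀ G {c : Comp} H → length G < length (G ++ c ∷ H)
length-G< G H = subst (_ <_) (sym (length-++ G)) (m<m+n (length G) (s≤s z≤n))

length-insert : ∀ G {c N : Comp} H → length (G ++ c ∷ N ∷ H) ≡ suc (length (G ++ c ∷ H))
length-insert G H = trans (length-++ G) (trans (+-suc (length G) _) (cong suc (sym (length-++ G))))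

-- The `J ⊔`
-- keeps the map monotone without assuming J ≤ f (suc k); cover-insert needs that only when components
-- follow the inserted one.
insertAt : ℕ → ℕ → (ℕ → ℕ) → ℕ → ℕ
insertAt k J f p with p ≤? k
... | yes _ = f p
... | no _ = J ⊔ f (pred p)

insertAt-≤ : ∀ {k J f p} → p ≤ k → insertAt k J f p ≡ f p
insertAt-≤ {k} {p = p} p≤k with p ≤? k
... | yes _ = refl
... | no p≰k = ⊥-elim (p≰k p≤k)

insertAt-beyond : ∀ {k J f} q → insertAt k J f (k + suc q) ≡ J ⊔ f (k + q)
insertAt-beyond {k} {J} {f} q with k + suc q ≤? k
... | yes k+suc≤k = ⊥-elim (+suc≰ k q k+suc≤k)
... | no _ = cong (λ p → J ⊔ f (pred p)) (+-suc k q)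

insertAt-mono : ∀ {k J f} → (∀ {p q} → p ≤ q → f p ≤ f q) → f k ≤ J →
  ∀ {p q} → p ≤ q → insertAt k J f p ≤ insertAt k J f q
insertAt-mono {k} {J} {f} mono fk≤J {p} {q} p≤q with p ≤? k | q ≤? k
... | yes _ | yes _ = mono p≤q
... | yes p≤k | no _ = ≤-trans (mono p≤k) (≤-trans fk≤J (m≤m⊔n J _))
... | no p≰k | yes q≤k = ⊥-elim (p≰k (≤-trans p≤q q≤k))
... | no _ | no _ = ⊔-monoʳ-≤ J (mono (pred-mono-≤ p≤q))

occurs-insert : ∀ {s} G {c N H} (P : ℕ → Formula → Set) {f J} →
  (∀ {p X} → Occurs s (G ++ c ∷ H) p X → P (f p) X) → (∀ {X} → X ∈ s N → P J X) →
  f (length G) ≤ J → (∀ {q} → q < length H → J ≤ f (length G + suc q)) →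
  ∀ {p X} → Occurs s (G ++ c ∷ N ∷ H) p X → P (insertAt (length G) J f p) X
occurs-insert {s} G {c} {N} {H} P {f} {J} old new fk≤J J≤later x∈ = placed (locate G x∈)
  where
  g = insertAt (length G) J f
  below : ∀ {p} → p ≤ length G → g p ≡ f p
  below = insertAt-≤ {length G} {J} {f}
  beyond : ∀ q → g (length G + suc q) ≡ J ⊔ f (length G + q)
  beyond = insertAt-beyond {length G} {J} {f}
  relevel : ∀ {m n X} → m ≡ n → P n X → P m X
  relevel eq = subst (λ n → P n _) (sym eq)
  placed : ∀ {p X} → Located s G c (N ∷ H) p X → P (g p) X
  placed (before p< x∈) = relevel (below (<⇒≤ p<)) (old (occurs-before G (c ∷ H) x∈))
  placed (at x∈) = relevel (below ≤-refl) (old (occurs-here G x∈))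
  placed (after {zero} x∈N) =
    relevel (trans (beyond 0) (m≥n⇒m⊔n≡m (subst (λ k → f k ≤ J) (sym (+-identityʳ (length G))) fk≤J))) (new x∈N)
  placed (after {suc q} x∈H) =
    relevel (trans (beyond (suc q)) (m≤n⇒m⊔n≡n (J≤later (occurs-< H x∈H)))) (old (occurs-after G x∈H))

cover-insert : ∀ G {c N H T f σ} J → Cover (G ++ c ∷ H) T f σ → f (length G) ≤ J → J < length T →
  H ≡ [] ⊎ J ≤ f (suc (length G)) → Implied T J σ N → Cover (G ++ c ∷ N ∷ H) T (insertAt (length G) J f) σ
cover-insert G {c} {N} {H} {T} {f} {σ} J C fk≤J J<T last⊎J≤ (newˡ , newʳ) = record
  { monotone = insertAt-mono (monotone C) fk≤J
  ; bounded  = bounded′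
  ; coverˡ   = occurs-insert G (λ p X → Impliedˡ T p (X ⟪ σ ⟫)) (coverˡ C) newˡ fk≤J (J≤later last⊎J≤)
  ; coverʳ   = occurs-insert G (λ p X → Impliedʳ T p (X ⟪ σ ⟫)) (coverʳ C) newʳ fk≤J (J≤later last⊎J≤)
  }
  where
  J≤later : H ≡ [] ⊎ J ≤ f (suc (length G)) → ∀ {q} → q < length H → J ≤ f (length G + suc q)
  J≤later (inj₁ H≡[]) q< = ⊥-elim (n≮0 (subst (λ H → _ < length H) H≡[] q<))
  J≤later (inj₂ J≤) {q} _ = ≤-trans J≤ (monotone C (suc≤+suc (length G) q))
  bounded′ : ∀ {p} → p < length (G ++ c ∷ N ∷ H) → insertAt (length G) J f p < length T
  bounded′ {p} p< with p ≤? length G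
  ... | yes p≤k = bounded C (≤-<-trans p≤k (length-G< G H))
  bounded′ {zero} p< | no 0≰k = ⊥-elim (0≰k z≤n)
  bounded′ {suc p} p< | no _ = ⊔-pres-<m J<T (bounded C (≤-pred (subst (suc p <_) (length-insert G H) p<)))

shiftAfter : ℕ → ℕ → ℕ
shiftAfter k p with p ≤? k
... | yes _ = p
... | no _ = suc p

shiftAfter-≤ : ∀ {k p} → p ≤ k → shiftAfter k p ≡ p
shiftAfter-≤ {k} {p} p≤k with p ≤? k
... | yes _ = refl
... | no p≰k = ⊥-elim (p≰k p≤k)

shiftAfter-beyond : ∀ k q → shiftAfter k (k + suc q) ≡ k + suc (suc q)
shiftAfter-beyond k q with k + suc q ≤? k
... | yes k+suc≤k = ⊥-elim (+suc≰ k q k+suc≤k)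
... | no _ = sym (+-suc k (suc q))

shiftAfter-mono : ∀ {k p q} → p ≤ q → shiftAfter k p ≤ shiftAfter k q
shiftAfter-mono {k} {p} {q} p≤q with p ≤? k | q ≤? k
... | yes _ | yes _ = p≤q
... | yes _ | no _ = m≤n⇒m≤1+n p≤q
... | no p≰k | yes q≤k = ⊥-elim (p≰k (≤-trans p≤q q≤k))
... | no _ | no _ = s≤s p≤q

shiftAfter-≤-suc : ∀ {k p} → p ≤ k → shiftAfter k p ≤ suc k
shiftAfter-≤-suc p≤k = ≤-trans (≤-reflexive (shiftAfter-≤ p≤k)) (m≤n⇒m≤1+n p≤k)

suc≤shiftAfter : ∀ {k p} → k < p → suc k ≤ shiftAfter k p
suc≤shiftAfter {k} {p} k<p with p ≤? k
... | yes p≤k = ⊥-elim (<-irrefl refl (<-≤-trans k<p p≤k))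
... | no _ = m≤n⇒m≤1+n k<p

occurs-shift : ∀ {s} G {c N H p X} → Occurs s (G ++ c ∷ H) p X →
  Occurs s (G ++ c ∷ N ∷ H) (shiftAfter (length G) p) X
occurs-shift {s} G {c} {N} {H} x∈ = placed (locate G x∈)
  where
  relevel : ∀ {m n X} → m ≡ n → Occurs s (G ++ c ∷ N ∷ H) n X → Occurs s (G ++ c ∷ N ∷ H) m X
  relevel {X = X} eq = subst (λ n → Occurs s (G ++ c ∷ N ∷ H) n X) (sym eq)
  placed : ∀ {p X} → Located s G c H p X → Occurs s (G ++ c ∷ N ∷ H) (shiftAfter (length G) p) X
  placed (before p< x∈) = relevel (shiftAfter-≤ (<⇒≤ p<)) (occurs-before G (c ∷ N ∷ H) x∈)
  placed (at x∈) = relevel (shiftAfter-≤ ≤-refl) (occurs-here G x∈)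
  placed (after {q} x∈) = relevel (shiftAfter-beyond (length G) q) (occurs-after G {c} {N ∷ H} {suc q} x∈)

cover-insert-component : ∀ G {c N H} → Cover (G ++ c ∷ H) (G ++ c ∷ N ∷ H) (shiftAfter (length G)) id
cover-insert-component G {c} {N} {H} = record
  { monotone = shiftAfter-mono
  ; bounded  = bounded′
  ; coverˡ   = λ {_} {X} x∈ → subst (Impliedˡ _ _) (sym (rename-id X)) (present ≤-refl (occurs-shift G x∈))
  ; coverʳ   = λ {_} {X} x∈ → subst (Impliedʳ _ _) (sym (rename-id X)) (present ≤-refl (occurs-shift G x∈))
  }
  where
  bounded′ : ∀ {p} → p < length (G ++ c ∷ H) → shiftAfter (length G) p < length (G ++ c ∷ N ∷ H)
  bounded′ {p} p< with p ≤? length G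
  ... | yes _ = subst (p <_) (sym (length-insert G H)) (m≤n⇒m≤1+n p<)
  ... | no _ = subst (suc p <_) (sym (length-insert G H)) (s≤s p<)

data Split (s : Side) : LNS → ℕ → Formula → Set where
  split : ∀ G c H {X} → X ∈ s c → Split s (G ++ c ∷ H) (length G) X

split-occurs : ∀ {s} T {j X} → Occurs s T j X → Split s T j X
split-occurs (c ∷ T) {zero} x∈ = split [] c T x∈
split-occurs (c ∷ T) {suc j} x∈ with split-occurs T x∈
... | split G d H x∈′ = split (c ∷ G) d H x∈′

∈⇒↭∷ : ∀ {X : Formula} {Γ} → X ∈ Γ → ∃ λ Γ′ → Γ ↭ X ∷ Γ′
∈⇒↭∷ {X} x∈ with ∈-∃++ x∈
... | ys , zs , refl = ys ++ zs , shift X ys zs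

record Focusˡ (T : LNS) (j : ℕ) (X : Formula) : Set where
  constructor focusedˡ
  field
    G : LNS
    Γ Δ : List Formula
    H : LNS
    length-G : length G ≡ j
    focused : T ≈S (G ++ (X ∷ Γ ⊢ Δ) ∷ H)

record Focusʳ (T : LNS) (j : ℕ) (X : Formula) : Set where
  constructor focusedʳ
  field
    G : LNS
    Γ Δ : List Formula
    H : LNS
    length-G : length G ≡ j
    focused : T ≈S (G ++ (Γ ⊢ X ∷ Δ) ∷ H)

focusˡ : ∀ {T j X} → Occursˡ T j X → Focusˡ T j X
focusˡ {T} x∈ with split-occurs T x∈
... | split G (Γ ⊢ Δ) H x∈Γ with ∈⇒↭∷ x∈Γ
...   | Γ′ , Γ↭ = focusedˡ G Γ′ Δ H refl (≈S-at G H (Γ↭ , ↭-refl))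

focusʳ : ∀ {T j X} → Occursʳ T j X → Focusʳ T j X
focusʳ {T} x∈ with split-occurs T x∈
... | split G (Γ ⊢ Δ) H x∈Δ with ∈⇒↭∷ x∈Δ
...   | Δ′ , Δ↭ = focusedʳ G Γ Δ′ H refl (≈S-at G H (↭-refl , Δ↭))

unfocus : ∀ {T T₀} → T ≈S T₀ → LNIF T₀ → LNIF T
unfocus T≈ d = mset d (≈S-sym T≈)

Cover-≈-id : ∀ {T T₀} → T ≈S T₀ → Cover T T₀ id id
Cover-≈-id T≈ = Cover-≈ T≈ (Cover-id _)

axiom : ∀ T {j k p ts} → Occursˡ T j (atom p ts) → Occursʳ T k (atom p ts) → j ≤ k → LNIF T
axiom T x∈ˡ x∈ʳ j≤k with split-occurs T x∈ˡ
... | split G (Γ ⊢ Δ) H x∈Γ with locate G x∈ʳ | ∈⇒↭∷ x∈Γ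
...   | before k< _ | _ = ⊥-elim (<-irrefl refl (<-≤-trans k< j≤k))
...   | at x∈Δ | Γ′ , Γ↭ with ∈⇒↭∷ x∈Δ
...     | Δ′ , Δ↭ = unfocus (≈S-at G H (Γ↭ , Δ↭)) (id₁ G Γ′ Δ′ H _ _)
axiom T x∈ˡ x∈ʳ j≤k | split G (Γ ⊢ Δ) H x∈Γ | after x∈H | Γ′ , Γ↭ with split-occurs H x∈H
... | split M (Γ₂ ⊢ Δ₂) F x∈Δ₂ with ∈⇒↭∷ x∈Δ₂
...   | Δ₂′ , Δ₂↭ = unfocus (Pointwise.++⁺ (≈S-refl G) ((Γ↭ , ↭-refl) ∷ ≈S-at M F (↭-refl , Δ₂↭)))
                            (id₂ G Γ′ Δ M Γ₂ Δ₂′ F _ _)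

lift-forward : ∀ n {T j X} → j + n < length T → Occursˡ T j X →
  (∀ {T′} → Cover T T′ id id → Occursˡ T′ (j + n) X → LNIF T′) → LNIF T
lift-forward zero {T} {j} {X} _ x∈ K = K (Cover-id T) (subst (λ m → Occursˡ T m X) (sym (+-identityʳ j)) x∈)
lift-forward (suc n) {T} {j} {X} j+n< x∈ K with focusˡ {T} {j} {X} x∈
... | focusedˡ G Γ Δ [] refl T≈ =
  ⊥-elim (+suc≰ (length G) n (≤-pred (subst (_ <_) (trans (Pointwise-length T≈) (length-∷ʳ G)) j+n<)))
... | focusedˡ G Γ Δ ((Γ₂ ⊢ Δ₂) ∷ H) refl T≈ =
  unfocus T≈ (lift (lift-forward n bound (occurs-next G (here refl)) K′))
  where
  T₁ = G ++ (X ∷ Γ ⊢ Δ) ∷ (X ∷ Γ₂ ⊢ Δ₂) ∷ H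
  to-T₁ : Cover T T₁ id id
  to-T₁ = Cover-≈-id T≈ ⨾ cover-weaken₂ G (inj₁ , inj₁) (inj₁ ∘ there , inj₁)
  bound : suc (length G) + n < length T₁
  bound = subst₂ _<_ (+-suc (length G) n) (trans (Pointwise-length T≈) (length-middle G refl)) j+n<
  K′ : ∀ {T′} → Cover T₁ T′ id id → Occursˡ T′ (suc (length G) + n) X → LNIF T′
  K′ {T′} C x∈′ = K (to-T₁ ⨾ C) (subst (λ m → Occursˡ T′ m X) (sym (+-suc (length G) n)) x∈′)

-- Inversion of implied formulas

presentˡ : ∀ G {c H X} → X ∈ Comp.ante c → Impliedˡ (G ++ c ∷ H) (length G) X
presentˡ G x∈ = present ≤-refl (occurs-here G x∈)

presentʳ : ∀ G {c H X} → X ∈ Comp.succ c → Impliedʳ (G ++ c ∷ H) (length G) X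
presentʳ G x∈ = present ≤-refl (occurs-here G x∈)

Impliedˡ-⊥ : ∀ {T j} → Impliedˡ T j ⊥' → LNIF T
Impliedˡ-⊥ {T} (present _ x∈) with focusˡ {T} {_} {⊥'} x∈
... | focusedˡ G Γ Δ H _ T≈ = unfocus T≈ (⊥l G Γ Δ H)

Implied-axiom : ∀ {T j k p ts} → Impliedˡ T j (atom p ts) → Impliedʳ T k (atom p ts) → j ≤ k → LNIF T
Implied-axiom {T} (present j′≤j x∈ˡ) (present k≤k′ x∈ʳ) j≤k = axiom T x∈ˡ x∈ʳ (≤-trans j′≤j (≤-trans j≤k k≤k′))

∧ˡ-inversion : ∀ {T j A B} → Impliedˡ T j (A ∧' B) →
  (∀ {T′} → Cover T T′ id id → Impliedˡ T′ j A → Impliedˡ T′ j B → LNIF T′) → LNIF T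
∧ˡ-inversion (∧⁺ a b) K = K (Cover-id _) a b
∧ˡ-inversion {T} {j} {A} {B} (present j′≤j x∈) K with focusˡ {T} {_} {A ∧' B} x∈
... | focusedˡ G Γ Δ H refl T≈ =
  unfocus T≈ (∧l (K (Cover-≈-id T≈ ⨾ cover-weaken G (decompose , inj₁))
                    (at-j (here refl)) (at-j (there (here refl)))))
  where
  T₁ = G ++ (A ∷ B ∷ Γ ⊢ Δ) ∷ H
  at-j : ∀ {X} → X ∈ A ∷ B ∷ Γ → Impliedˡ T₁ j X
  at-j x∈ = present j′≤j (occurs-here G x∈)
  decompose : ∀ {X} → X ∈ A ∧' B ∷ Γ → X ∈ A ∷ B ∷ Γ ⊎ Impliedˡ T₁ (length G) X
  decompose (here refl) = inj₂ (∧⁺ (presentˡ G (here refl)) (presentˡ G (there (here refl))))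
  decompose (there x∈) = inj₁ (there (there x∈))

∨ˡ-inversion : ∀ {T j A B} → Impliedˡ T j (A ∨' B) →
  (∀ {T′} → Cover T T′ id id → Impliedˡ T′ j A → LNIF T′) →
  (∀ {T′} → Cover T T′ id id → Impliedˡ T′ j B → LNIF T′) → LNIF T
∨ˡ-inversion (∨⁺₁ a) K₁ K₂ = K₁ (Cover-id _) a
∨ˡ-inversion (∨⁺₂ b) K₁ K₂ = K₂ (Cover-id _) b
∨ˡ-inversion {T} {j} {A} {B} (present j′≤j x∈) K₁ K₂ with focusˡ {T} {_} {A ∨' B} x∈
... | focusedˡ G Γ Δ H refl T≈ =
  unfocus T≈ (∨l (K₁ (Cover-≈-id T≈ ⨾ cover-weaken G (decompose ∨⁺₁ , inj₁)) at-j)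
                 (K₂ (Cover-≈-id T≈ ⨾ cover-weaken G (decompose ∨⁺₂ , inj₁)) at-j))
  where
  at-j : ∀ {C} → Impliedˡ (G ++ (C ∷ Γ ⊢ Δ) ∷ H) j C
  at-j = present j′≤j (occurs-here G (here refl))
  decompose : ∀ {C} → (∀ {U k} → Impliedˡ U k C → Impliedˡ U k (A ∨' B)) →
    ∀ {X} → X ∈ A ∨' B ∷ Γ → X ∈ C ∷ Γ ⊎ Impliedˡ (G ++ (C ∷ Γ ⊢ Δ) ∷ H) (length G) X
  decompose intro (here refl) = inj₂ (intro (presentˡ G (here refl)))
  decompose intro (there x∈) = inj₁ (there x∈)

-- ⊃l needs A on the right of the very component holding A ⊃ B, so the implication is first lifted to j.
⊃ˡ-inversion : ∀ {T j A B} → Impliedˡ T j (A ⊃ B) → j < length T →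
  (∀ {T′} → Cover T T′ id id → Impliedˡ T′ j B → LNIF T′) →
  (∀ {T′} → Cover T T′ id id → Impliedʳ T′ j A → LNIF T′) → LNIF T
⊃ˡ-inversion (⊃⁺ b) _ K₁ K₂ = K₁ (Cover-id _) b
⊃ˡ-inversion {T} {j} {A} {B} (present {j′} j′≤j x∈) j<T K₁ K₂ =
  lift-forward (j ∸ j′) (subst (_< length T) (sym (m+[n∸m]≡n j′≤j)) j<T) x∈ λ {T′} C x∈′ →
    apply C (subst (λ k → Occursˡ T′ k (A ⊃ B)) (m+[n∸m]≡n j′≤j) x∈′)
  where
  apply : ∀ {T′} → Cover T T′ id id → Occursˡ T′ j (A ⊃ B) → LNIF T′
  apply {T′} C x∈ with focusˡ {T′} {j} {A ⊃ B} x∈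
  ... | focusedˡ G Γ Δ H refl T≈ =
    unfocus T≈ (⊃l (K₁ (C ⨾ Cover-≈-id T≈ ⨾ cover-weaken G (decompose , inj₁)) (presentˡ G (here refl)))
                   (K₂ (C ⨾ Cover-≈-id T≈ ⨾ cover-weaken G (inj₁ , inj₁ ∘ there)) (presentʳ G (here refl))))
    where
    decompose : ∀ {X} → X ∈ A ⊃ B ∷ Γ → X ∈ B ∷ Γ ⊎ Impliedˡ (G ++ (B ∷ Γ ⊢ Δ) ∷ H) (length G) X
    decompose (here refl) = inj₂ (⊃⁺ (presentˡ G (here refl)))
    decompose (there x∈) = inj₁ (there x∈)

∃ˡ-inversion : ∀ {T j x A} → Impliedˡ T j (∃' x A) →
  (∀ {T′} → Cover T T′ id id → ∀ t → Impliedˡ T′ j (A [ t / x ]) → LNIF T′) → LNIF T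
∃ˡ-inversion (∃⁺ t a) K = K (Cover-id _) t a
∃ˡ-inversion {T} {j} {x} {A} (present j′≤j x∈) K with focusˡ {T} {_} {∃' x A} x∈
... | focusedˡ G Γ Δ H refl T≈ with fresh (paramsS (G ++ (∃' x A ∷ Γ ⊢ Δ) ∷ H))
...   | b , b∉ =
  unfocus T≈ (∃l b b∉ (K (Cover-≈-id T≈ ⨾ cover-weaken G (decompose , inj₁)) b
                         (present j′≤j (occurs-here G (here refl)))))
  where
  T₁ = G ++ (A [ b / x ] ∷ Γ ⊢ Δ) ∷ H
  decompose : ∀ {X} → X ∈ ∃' x A ∷ Γ → X ∈ A [ b / x ] ∷ Γ ⊎ Impliedˡ T₁ (length G) X
  decompose (here refl) = inj₂ (∃⁺ b (presentˡ G (here refl)))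
  decompose (there x∈) = inj₁ (there x∈)

∀ˡ-inversion : ∀ {T j x A} t → Impliedˡ T j (∀' x A) →
  (∀ {T′} → Cover T T′ id id → Impliedˡ T′ j (A [ t / x ]) → LNIF T′) → LNIF T
∀ˡ-inversion {T} {j} {x} {A} t (present j′≤j x∈) K with focusˡ {T} {_} {∀' x A} x∈
... | focusedˡ G Γ Δ H refl T≈ =
  unfocus T≈ (∀l t (K (Cover-≈-id T≈ ⨾ cover-weaken G (inj₁ ∘ there , inj₁))
                      (present j′≤j (occurs-here G (here refl)))))

∧ʳ-inversion : ∀ {T j A B} → Impliedʳ T j (A ∧' B) →
  (∀ {T′} → Cover T T′ id id → Impliedʳ T′ j A → LNIF T′) →
  (∀ {T′} → Cover T T′ id id → Impliedʳ T′ j B → LNIF T′) → LNIF T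
∧ʳ-inversion (∧⁺₁ a) K₁ K₂ = K₁ (Cover-id _) a
∧ʳ-inversion (∧⁺₂ b) K₁ K₂ = K₂ (Cover-id _) b
∧ʳ-inversion {T} {j} {A} {B} (present j≤j′ x∈) K₁ K₂ with focusʳ {T} {_} {A ∧' B} x∈
... | focusedʳ G Γ Δ H refl T≈ =
  unfocus T≈ (∧r (K₁ (Cover-≈-id T≈ ⨾ cover-weaken G (inj₁ , decompose ∧⁺₁)) at-j)
                 (K₂ (Cover-≈-id T≈ ⨾ cover-weaken G (inj₁ , decompose ∧⁺₂)) at-j))
  where
  at-j : ∀ {C} → Impliedʳ (G ++ (Γ ⊢ C ∷ Δ) ∷ H) j C
  at-j = present j≤j′ (occurs-here G (here refl))
  decompose : ∀ {C} → (∀ {U k} → Impliedʳ U k C → Impliedʳ U k (A ∧' B)) →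
    ∀ {X} → X ∈ A ∧' B ∷ Δ → X ∈ C ∷ Δ ⊎ Impliedʳ (G ++ (Γ ⊢ C ∷ Δ) ∷ H) (length G) X
  decompose intro (here refl) = inj₂ (intro (presentʳ G (here refl)))
  decompose intro (there x∈) = inj₁ (there x∈)

∨ʳ-inversion : ∀ {T j A B} → Impliedʳ T j (A ∨' B) →
  (∀ {T′} → Cover T T′ id id → Impliedʳ T′ j A → Impliedʳ T′ j B → LNIF T′) → LNIF T
∨ʳ-inversion (∨⁺ a b) K = K (Cover-id _) a b
∨ʳ-inversion {T} {j} {A} {B} (present j≤j′ x∈) K with focusʳ {T} {_} {A ∨' B} x∈
... | focusedʳ G Γ Δ H refl T≈ =
  unfocus T≈ (∨r (K (Cover-≈-id T≈ ⨾ cover-weaken G (inj₁ , decompose))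
                    (at-j (here refl)) (at-j (there (here refl)))))
  where
  T₁ = G ++ (Γ ⊢ A ∷ B ∷ Δ) ∷ H
  at-j : ∀ {X} → X ∈ A ∷ B ∷ Δ → Impliedʳ T₁ j X
  at-j x∈ = present j≤j′ (occurs-here G x∈)
  decompose : ∀ {X} → X ∈ A ∨' B ∷ Δ → X ∈ A ∷ B ∷ Δ ⊎ Impliedʳ T₁ (length G) X
  decompose (here refl) = inj₂ (∨⁺ (presentʳ G (here refl)) (presentʳ G (there (here refl))))
  decompose (there x∈) = inj₁ (there (there x∈))

∃ʳ-inversion : ∀ {T j x A} t → Impliedʳ T j (∃' x A) →
  (∀ {T′} → Cover T T′ id id → Impliedʳ T′ j (A [ t / x ]) → LNIF T′) → LNIF T
∃ʳ-inversion {T} {j} {x} {A} t (present j≤j′ x∈) K with focusʳ {T} {_} {∃' x A} x∈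
... | focusedʳ G Γ Δ H refl T≈ =
  unfocus T≈ (∃r t (K (Cover-≈-id T≈ ⨾ cover-weaken G (inj₁ , inj₁ ∘ there))
                      (present j≤j′ (occurs-here G (here refl)))))

Present : LNS → ℕ → Comp → Set
Present T j c = (∀ {X} → X ∈ Comp.ante c → Occursˡ T j X) × (∀ {X} → X ∈ Comp.succ c → Occursʳ T j X)

-- The common shape of ⊃r₁/⊃r₂ and ∀r₁/∀r₂: Y is decomposed into a child component inserted right
-- after its own. The child may depend on the conclusion, so that ∀ can take a fresh eigenvariable.
record Nesting (Y : Formula) : Set where
  field
    child : LNS → Comp
    nest₁ : ∀ {G Γ Δ} → LNIF (G ++ (Γ ⊢ Δ) ∷ [ child (G ++ [ Γ ⊢ Y ∷ Δ ]) ]) → LNIF (G ++ [ Γ ⊢ Y ∷ Δ ])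
    nest₂ : ∀ {G Γ₁ Δ₁ Γ₂ Δ₂ H} →
      LNIF (G ++ (Γ₁ ⊢ Δ₁) ∷ child (G ++ (Γ₁ ⊢ Y ∷ Δ₁) ∷ (Γ₂ ⊢ Δ₂) ∷ H) ∷ (Γ₂ ⊢ Δ₂) ∷ H) →
      LNIF (G ++ (Γ₁ ⊢ Δ₁) ∷ (Γ₂ ⊢ Y ∷ Δ₂) ∷ H) →
      LNIF (G ++ (Γ₁ ⊢ Y ∷ Δ₁) ∷ (Γ₂ ⊢ Δ₂) ∷ H)
    child-implies : ∀ G {c H} T₀ → Impliedʳ (G ++ c ∷ child T₀ ∷ H) (length G) Y
open Nesting

⊃-nesting : ∀ A B → Nesting (A ⊃ B)
⊃-nesting A B = record
  { child = λ _ → [ A ] ⊢ [ B ]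
  ; nest₁ = ⊃r₁
  ; nest₂ = ⊃r₂
  ; child-implies = λ G _ → ⊃⁺ (n≤1+n _) (present ≤-refl (occurs-next G (here refl)))
                                          (present ≤-refl (occurs-next G (here refl)))
  }

∀-nesting : ∀ x A → Nesting (∀' x A)
∀-nesting x A = record
  { child = λ T₀ → [] ⊢ [ A [ proj₁ (fresh (paramsS T₀)) / x ] ]
  ; nest₁ = ∀r₁ _ (proj₂ (fresh _))
  ; nest₂ = ∀r₂ _ (proj₂ (fresh _))
  ; child-implies = λ G T₀ → ∀⁺ (n≤1+n _) (proj₁ (fresh (paramsS T₀))) (present ≤-refl (occurs-next G (here refl)))
  }

module _ {Y} (N : Nesting Y) {T j} (Continue : ℕ → Set)
  (stop : ∀ {T′} j′ → Cover T T′ id id → Occursʳ T′ j′ Y → LNIF T′ ⊎ Continue j′)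
  (nest : ∀ {T′} j′ T₀ → Cover T T′ (shiftAfter j′) id → j ≤ j′ → Continue j′ →
          Present T′ (suc j′) (child N T₀) → LNIF T′)
  where

  into-child : ∀ G {Γ Δ H} → let T₀ = G ++ (Γ ⊢ Y ∷ Δ) ∷ H in
    Cover T₀ (G ++ (Γ ⊢ Δ) ∷ child N T₀ ∷ H) (shiftAfter (length G)) id
  into-child G {Γ} {Δ} {H} = cover-insert-component G ⨾ cover-weaken G (inj₁ , implied)
    where
    implied : ∀ {X} → X ∈ Y ∷ Δ →
      X ∈ Δ ⊎ Impliedʳ (G ++ (Γ ⊢ Δ) ∷ child N (G ++ (Γ ⊢ Y ∷ Δ) ∷ H) ∷ H) (length G) X
    implied (here refl) = inj₂ (child-implies N G _)
    implied (there x∈) = inj₁ x∈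

  -- Y is pushed through later components with nest₂ until stop applies or Y reaches the last one;
  -- n bounds the number of components still ahead.
  walk-right : ∀ n {T′} j′ → Cover T T′ id id → Occursʳ T′ j′ Y → j ≤ j′ → length T′ ≤ j′ + n → LNIF T′
  walk-right zero {T′} j′ C x∈ _ T′≤ =
    ⊥-elim (<-irrefl refl (<-≤-trans (occurs-< T′ x∈) (subst (length T′ ≤_) (+-identityʳ j′) T′≤)))
  walk-right (suc n) {T′} j′ C x∈ j≤j′ T′≤ with stop j′ C x∈
  ... | inj₁ d = d
  ... | inj₂ continue with focusʳ {T′} {j′} {Y} x∈
  ...   | focusedʳ G Γ Δ [] refl T≈ =
    unfocus T≈ (nest₁ N (nest (length G) _ (C ⨾ Cover-≈-id T≈ ⨾ into-child G) j≤j′ continue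
                              (occurs-next G , occurs-next G)))
  ...   | focusedʳ G Γ Δ ((Γ₂ ⊢ Δ₂) ∷ H) refl T≈ =
    unfocus T≈ (nest₂ N (nest (length G) _ (C ⨾ Cover-≈-id T≈ ⨾ into-child G) j≤j′ continue
                              (occurs-next G , occurs-next G))
                        (walk-right n (suc (length G)) (C ⨾ Cover-≈-id T≈ ⨾ move) (occurs-next G (here refl))
                                    (≤-trans j≤j′ (n≤1+n _)) bound))
    where
    T₁ = G ++ (Γ ⊢ Δ) ∷ (Γ₂ ⊢ Y ∷ Δ₂) ∷ H
    moved : ∀ {X} → X ∈ Y ∷ Δ → X ∈ Δ ⊎ Impliedʳ T₁ (length G) X
    moved (here refl) = inj₂ (present (n≤1+n _) (occurs-next G (here refl)))
    moved (there x∈) = inj₁ x∈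
    move : Cover (G ++ (Γ ⊢ Y ∷ Δ) ∷ (Γ₂ ⊢ Δ₂) ∷ H) T₁ id id
    move = cover-weaken₂ G (inj₁ , moved) (inj₁ , inj₁ ∘ there)
    bound : length T₁ ≤ suc (length G) + n
    bound = subst₂ _≤_ (trans (Pointwise-length T≈) (length-middle G refl)) (+-suc (length G) n) T′≤

nested-right : ∀ {Y} (N : Nesting Y) {T j j′} → j ≤ j′ → Occursʳ T j′ Y →
  (∀ {T′ g} J T₀ → Cover T T′ g id → g j ≤ J → Present T′ J (child N T₀) → LNIF T′) → LNIF T
nested-right N {T} {j} {j′} j≤j′ x∈ K =
  walk-right N (λ _ → ⊤) (λ _ _ _ → inj₂ tt) nest (length T) j′ (Cover-id T) x∈ j≤j′ (m≤n+m (length T) j′)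
  where
  nest : ∀ {T′} j″ T₀ → Cover T T′ (shiftAfter j″) id → j ≤ j″ → ⊤ →
    Present T′ (suc j″) (child N T₀) → LNIF T′
  nest j″ T₀ C j≤j″ _ = K (suc j″) T₀ C (shiftAfter-≤-suc j≤j″)

nested-right-below : ∀ {Y} (N : Nesting Y) {T j j′} m → j ≤ j′ → Occursʳ T j′ Y →
  (∀ {T′ g} J T₀ → Cover T T′ g id → g j ≤ J → J ≤ g m → Present T′ J (child N T₀) → LNIF T′) →
  (∀ {T′} → Cover T T′ id id → Impliedʳ T′ m Y → LNIF T′) → LNIF T
nested-right-below {Y} N {T} {j} {j′} m j≤j′ x∈ K K₂ =
  walk-right N (_< m) stop nest (length T) j′ (Cover-id T) x∈ j≤j′ (m≤n+m (length T) j′)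
  where
  stop : ∀ {T′} j″ → Cover T T′ id id → Occursʳ T′ j″ Y → LNIF T′ ⊎ j″ < m
  stop j″ C x∈ with m ≤? j″
  ... | yes m≤j″ = inj₁ (K₂ C (present m≤j″ x∈))
  ... | no m≰j″ = inj₂ (≰⇒> m≰j″)
  nest : ∀ {T′} j″ T₀ → Cover T T′ (shiftAfter j″) id → j ≤ j″ → j″ < m →
    Present T′ (suc j″) (child N T₀) → LNIF T′
  nest j″ T₀ C j≤j″ j″<m = K (suc j″) T₀ C (shiftAfter-≤-suc j≤j″) (suc≤shiftAfter j″<m)

⊃ʳ-inversion : ∀ {T j A B} → Impliedʳ T j (A ⊃ B) →
  (∀ {T′ g} J → Cover T T′ g id → g j ≤ J → Impliedˡ T′ J A → Impliedʳ T′ J B → LNIF T′) → LNIF T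
⊃ʳ-inversion (⊃⁺ j≤J a b) K = K _ (Cover-id _) j≤J a b
⊃ʳ-inversion (present j≤j′ x∈) K =
  nested-right (⊃-nesting _ _) j≤j′ x∈ λ J _ C j≤J (pˡ , pʳ) →
    K J C j≤J (present ≤-refl (pˡ (here refl))) (present ≤-refl (pʳ (here refl)))

⊃ʳ-inversion-below : ∀ {T j A B} m → Impliedʳ T j (A ⊃ B) →
  (∀ {T′ g} J → Cover T T′ g id → g j ≤ J → J ≤ g m → Impliedˡ T′ J A → Impliedʳ T′ J B → LNIF T′) →
  (∀ {T′} → Cover T T′ id id → Impliedʳ T′ m (A ⊃ B) → LNIF T′) → LNIF T
⊃ʳ-inversion-below m (⊃⁺ {J} j≤J a b) K K₂ with J ≤? m
... | yes J≤m = K J (Cover-id _) j≤J J≤m a b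
... | no J≰m = K₂ (Cover-id _) (⊃⁺ (<⇒≤ (≰⇒> J≰m)) a b)
⊃ʳ-inversion-below m (present j≤j′ x∈) K K₂ =
  nested-right-below (⊃-nesting _ _) m j≤j′ x∈
    (λ J _ C j≤J J≤m (pˡ , pʳ) →
      K J C j≤J J≤m (present ≤-refl (pˡ (here refl))) (present ≤-refl (pʳ (here refl))))
    K₂

∀ʳ-inversion : ∀ {T j x A} → Impliedʳ T j (∀' x A) →
  (∀ {T′ g} J → Cover T T′ g id → g j ≤ J → ∀ t → Impliedʳ T′ J (A [ t / x ]) → LNIF T′) → LNIF T
∀ʳ-inversion (∀⁺ j≤J t a) K = K _ (Cover-id _) j≤J t a
∀ʳ-inversion (present j≤j′ x∈) K =
  nested-right (∀-nesting _ _) j≤j′ x∈ λ J _ C j≤J (_ , pʳ) → K J C j≤J _ (present ≤-refl (pʳ (here refl)))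

∀ʳ-inversion-below : ∀ {T j x A} m → Impliedʳ T j (∀' x A) →
  (∀ {T′ g} J → Cover T T′ g id → g j ≤ J → J ≤ g m → ∀ t → Impliedʳ T′ J (A [ t / x ]) → LNIF T′) →
  (∀ {T′} → Cover T T′ id id → Impliedʳ T′ m (∀' x A) → LNIF T′) → LNIF T
∀ʳ-inversion-below m (∀⁺ {J} j≤J t a) K K₂ with J ≤? m
... | yes J≤m = K J (Cover-id _) j≤J J≤m t a
... | no J≰m = K₂ (Cover-id _) (∀⁺ (<⇒≤ (≰⇒> J≰m)) t a)
∀ʳ-inversion-below m (present j≤j′ x∈) K K₂ =
  nested-right-below (∀-nesting _ _) m j≤j′ x∈
    (λ J _ C j≤J J≤m (_ , pʳ) → K J C j≤J J≤m _ (present ≤-refl (pʳ (here refl))))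
    K₂

-- Transport of derivations along covers

Transportable : LNS → Set
Transportable S = ∀ {T f σ} → Cover S T f σ → LNIF T

principalˡ : ∀ G {X Γ Δ H} → Occursˡ (G ++ (X ∷ Γ ⊢ Δ) ∷ H) (length G) X
principalˡ G = occurs-here G (here refl)

principalʳ : ∀ G {X Γ Δ H} → Occursʳ (G ++ (Γ ⊢ X ∷ Δ) ∷ H) (length G) X
principalʳ G = occurs-here G (here refl)

transportable-id₁ : ∀ G Γ Δ H p ts → Transportable (G ++ (atom p ts ∷ Γ ⊢ atom p ts ∷ Δ) ∷ H)
transportable-id₁ G Γ Δ H p ts C = Implied-axiom (coverˡ C (principalˡ G)) (coverʳ C (principalʳ G)) ≤-refl

transportable-id₂ : ∀ G Γ₁ Δ₁ H Γ₂ Δ₂ F p ts →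
  Transportable (G ++ (atom p ts ∷ Γ₁ ⊢ Δ₁) ∷ H ++ (Γ₂ ⊢ atom p ts ∷ Δ₂) ∷ F)
transportable-id₂ G Γ₁ Δ₁ H Γ₂ Δ₂ F p ts C =
  Implied-axiom (coverˡ C (principalˡ G)) (coverʳ C (occurs-after G (principalʳ H)))
                (monotone C (m≤m+n (length G) (suc (length H))))

transportable-⊥l : ∀ G Γ Δ H → Transportable (G ++ (⊥' ∷ Γ ⊢ Δ) ∷ H)
transportable-⊥l G Γ Δ H C = Impliedˡ-⊥ (coverˡ C (principalˡ G))

transportable-∧l : ∀ G {Γ Δ H A B} → Transportable (G ++ (A ∷ B ∷ Γ ⊢ Δ) ∷ H) →
  Transportable (G ++ (A ∧' B ∷ Γ ⊢ Δ) ∷ H)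
transportable-∧l G ih C = ∧ˡ-inversion (coverˡ C (principalˡ G)) λ D a b →
  ih (cover-replace G (C ⨾ D) (prepend (_ ∷ _ ∷ []) (a ∷ b ∷ []) there , inj₁))

transportable-∨r : ∀ G {Γ Δ H A B} → Transportable (G ++ (Γ ⊢ A ∷ B ∷ Δ) ∷ H) →
  Transportable (G ++ (Γ ⊢ A ∨' B ∷ Δ) ∷ H)
transportable-∨r G ih C = ∨ʳ-inversion (coverʳ C (principalʳ G)) λ D a b →
  ih (cover-replace G (C ⨾ D) (inj₁ , prepend (_ ∷ _ ∷ []) (a ∷ b ∷ []) there))

transportable-∧r : ∀ G {Γ Δ H A B} → Transportable (G ++ (Γ ⊢ A ∷ Δ) ∷ H) →
  Transportable (G ++ (Γ ⊢ B ∷ Δ) ∷ H) → Transportable (G ++ (Γ ⊢ A ∧' B ∷ Δ) ∷ H)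
transportable-∧r G ih₁ ih₂ C = ∧ʳ-inversion (coverʳ C (principalʳ G))
  (λ D a → ih₁ (cover-replace G (C ⨾ D) (inj₁ , prepend [ _ ] (a ∷ []) there)))
  (λ D b → ih₂ (cover-replace G (C ⨾ D) (inj₁ , prepend [ _ ] (b ∷ []) there)))

transportable-∨l : ∀ G {Γ Δ H A B} → Transportable (G ++ (A ∷ Γ ⊢ Δ) ∷ H) →
  Transportable (G ++ (B ∷ Γ ⊢ Δ) ∷ H) → Transportable (G ++ (A ∨' B ∷ Γ ⊢ Δ) ∷ H)
transportable-∨l G ih₁ ih₂ C = ∨ˡ-inversion (coverˡ C (principalˡ G))
  (λ D a → ih₁ (cover-replace G (C ⨾ D) (prepend [ _ ] (a ∷ []) there , inj₁)))
  (λ D b → ih₂ (cover-replace G (C ⨾ D) (prepend [ _ ] (b ∷ []) there , inj₁)))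

transportable-⊃l : ∀ G {Γ Δ H A B} → Transportable (G ++ (B ∷ Γ ⊢ Δ) ∷ H) →
  Transportable (G ++ (A ⊃ B ∷ Γ ⊢ A ∷ Δ) ∷ H) → Transportable (G ++ (A ⊃ B ∷ Γ ⊢ Δ) ∷ H)
transportable-⊃l G {H = H} ih₁ ih₂ C = ⊃ˡ-inversion (coverˡ C (principalˡ G)) (bounded C (length-G< G H))
  (λ D b → ih₁ (cover-replace G (C ⨾ D) (prepend [ _ ] (b ∷ []) there , inj₁)))
  (λ D a → ih₂ (cover-replace G (C ⨾ D) (inj₁ , prepend [ _ ] (a ∷ []) id)))

transportable-lift : ∀ G {Γ₁ Δ₁ Γ₂ Δ₂ H A} → Transportable (G ++ (A ∷ Γ₁ ⊢ Δ₁) ∷ (A ∷ Γ₂ ⊢ Δ₂) ∷ H) →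
  Transportable (G ++ (A ∷ Γ₁ ⊢ Δ₁) ∷ (Γ₂ ⊢ Δ₂) ∷ H)
transportable-lift G ih C = ih (cover-replace-next G C (prepend [ _ ] (a ∷ []) id , inj₁))
  where a = Impliedˡ-mono (monotone C (n≤1+n _)) (coverˡ C (principalˡ G))

transportable-∀l : ∀ G {Γ Δ H x A} a → Transportable (G ++ (A [ a / x ] ∷ ∀' x A ∷ Γ ⊢ Δ) ∷ H) →
  Transportable (G ++ (∀' x A ∷ Γ ⊢ Δ) ∷ H)
transportable-∀l G {x = x} {A} a ih {σ = σ} C = ∀ˡ-inversion (σ a) (coverˡ C (principalˡ G)) λ D a′ →
  ih (cover-replace G (C ⨾ D)
       (prepend [ _ ] (subst (Impliedˡ _ _) (sym (rename-subst σ A a x)) a′ ∷ []) id , inj₁))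

transportable-∃r : ∀ G {Γ Δ H x A} a → Transportable (G ++ (Γ ⊢ A [ a / x ] ∷ ∃' x A ∷ Δ) ∷ H) →
  Transportable (G ++ (Γ ⊢ ∃' x A ∷ Δ) ∷ H)
transportable-∃r G {x = x} {A} a ih {σ = σ} C = ∃ʳ-inversion (σ a) (coverʳ C (principalʳ G)) λ D a′ →
  ih (cover-replace G (C ⨾ D)
       (inj₁ , prepend [ _ ] (subst (Impliedʳ _ _) (sym (rename-subst σ A a x)) a′ ∷ []) id))

transportable-∃l : ∀ G {Γ Δ H x A} a → a ∉ paramsS (G ++ (∃' x A ∷ Γ ⊢ Δ) ∷ H) →
  Transportable (G ++ (A [ a / x ] ∷ Γ ⊢ Δ) ∷ H) → Transportable (G ++ (∃' x A ∷ Γ ⊢ Δ) ∷ H)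
transportable-∃l G {Γ} {Δ} {H} {x} {A} a a∉ ih {σ = σ} C = ∃ˡ-inversion (coverˡ C (principalˡ G)) λ D t a′ →
  ih (cover-replace G (cover-update t a∉ (C ⨾ D))
       (prepend [ _ ] (subst (Impliedˡ _ _) (sym (rename-eigenvariable σ t A x a∉A)) a′ ∷ []) there , inj₁))
  where
  a∉A : a ∉ params A
  a∉A = a∉ ∘ params-occursˡ (G ++ (∃' x A ∷ Γ ⊢ Δ) ∷ H) (principalˡ G)

transportable-⊃r₁ : ∀ G {Γ Δ A B} → Transportable (G ++ (Γ ⊢ Δ) ∷ [ [ A ] ⊢ [ B ] ]) →
  Transportable (G ++ [ Γ ⊢ A ⊃ B ∷ Δ ])
transportable-⊃r₁ G ih C = ⊃ʳ-inversion (coverʳ C (principalʳ G)) λ J D fk≤J a b →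
  ih (cover-replace G (cover-insert G J (C ⨾ D) fk≤J (Impliedʳ-< b) (inj₁ refl)
                                    (lookup (a ∷ []) , lookup (b ∷ [])))
                      (inj₁ , inj₁ ∘ there))

transportable-⊃r₂ : ∀ G {Γ₁ Δ₁ Γ₂ Δ₂ H A B} →
  Transportable (G ++ (Γ₁ ⊢ Δ₁) ∷ ([ A ] ⊢ [ B ]) ∷ (Γ₂ ⊢ Δ₂) ∷ H) →
  Transportable (G ++ (Γ₁ ⊢ Δ₁) ∷ (Γ₂ ⊢ A ⊃ B ∷ Δ₂) ∷ H) →
  Transportable (G ++ (Γ₁ ⊢ A ⊃ B ∷ Δ₁) ∷ (Γ₂ ⊢ Δ₂) ∷ H)
transportable-⊃r₂ G ih₁ ih₂ {T} {f} {σ} C = ⊃ʳ-inversion-below (f (suc (length G))) (coverʳ C (principalʳ G))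
  (λ J D fk≤J J≤m a b →
    ih₁ (cover-replace G (cover-insert G J (C ⨾ D) fk≤J (Impliedʳ-< b) (inj₂ J≤m)
                                       (lookup (a ∷ []) , lookup (b ∷ [])))
                         (inj₁ , inj₁ ∘ there)))
  (λ D a⊃b → ih₂ (cover-replace₂ G (C ⨾ D) (inj₁ , inj₁ ∘ there)
                                 (inj₁ , prepend {λ X → Impliedʳ _ _ (X ⟪ σ ⟫)} [ _ ] (a⊃b ∷ []) id)))
transportable-∀r₁ : ∀ G {Γ Δ x A} a → a ∉ paramsS (G ++ [ Γ ⊢ ∀' x A ∷ Δ ]) →
  Transportable (G ++ (Γ ⊢ Δ) ∷ [ [] ⊢ [ A [ a / x ] ] ]) → Transportable (G ++ [ Γ ⊢ ∀' x A ∷ Δ ])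
transportable-∀r₁ G {Γ} {Δ} {x} {A} a a∉ ih {σ = σ} C =
  ∀ʳ-inversion (coverʳ C (principalʳ G)) λ J D fk≤J t a′ →
    ih (cover-replace G (cover-insert G J (cover-update t a∉ (C ⨾ D)) fk≤J (Impliedʳ-< a′) (inj₁ refl)
                                      ((λ ()) , lookup (instance-at J t a′ ∷ [])))
                        (inj₁ , inj₁ ∘ there))
  where
  instance-at : ∀ {T′} J t →
    Impliedʳ T′ J ((A ⟪ σ ⟫) [ t / x ]) → Impliedʳ T′ J ((A [ a / x ]) ⟪ σ [ a ↦ t ] ⟫)
  instance-at J t = subst (Impliedʳ _ J) (sym (rename-eigenvariable σ t A x a∉A))
    where a∉A = a∉ ∘ params-occursʳ (G ++ [ Γ ⊢ ∀' x A ∷ Δ ]) (principalʳ G)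

transportable-∀r₂ : ∀ G {Γ₁ Δ₁ Γ₂ Δ₂ H x A} a → a ∉ paramsS (G ++ (Γ₁ ⊢ ∀' x A ∷ Δ₁) ∷ (Γ₂ ⊢ Δ₂) ∷ H) →
  Transportable (G ++ (Γ₁ ⊢ Δ₁) ∷ ([] ⊢ [ A [ a / x ] ]) ∷ (Γ₂ ⊢ Δ₂) ∷ H) →
  Transportable (G ++ (Γ₁ ⊢ Δ₁) ∷ (Γ₂ ⊢ ∀' x A ∷ Δ₂) ∷ H) →
  Transportable (G ++ (Γ₁ ⊢ ∀' x A ∷ Δ₁) ∷ (Γ₂ ⊢ Δ₂) ∷ H)
transportable-∀r₂ G {Γ₁} {Δ₁} {Γ₂} {Δ₂} {H} {x} {A} a a∉ ih₁ ih₂ {T} {f} {σ} C =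
  ∀ʳ-inversion-below (f (suc (length G))) (coverʳ C (principalʳ G))
    (λ J D fk≤J J≤m t a′ →
      ih₁ (cover-replace G (cover-insert G J (cover-update t a∉ (C ⨾ D)) fk≤J (Impliedʳ-< a′) (inj₂ J≤m)
                                         ((λ ()) , lookup (instance-at J t a′ ∷ [])))
                           (inj₁ , inj₁ ∘ there)))
    (λ D ∀xA → ih₂ (cover-replace₂ G (C ⨾ D) (inj₁ , inj₁ ∘ there)
                                   (inj₁ , prepend {λ X → Impliedʳ _ _ (X ⟪ σ ⟫)} [ _ ] (∀xA ∷ []) id)))
  where
  instance-at : ∀ {T′} J t →
    Impliedʳ T′ J ((A ⟪ σ ⟫) [ t / x ]) → Impliedʳ T′ J ((A [ a / x ]) ⟪ σ [ a ↦ t ] ⟫)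
  instance-at J t = subst (Impliedʳ _ J) (sym (rename-eigenvariable σ t A x a∉A))
    where a∉A = a∉ ∘ params-occursʳ (G ++ (Γ₁ ⊢ ∀' x A ∷ Δ₁) ∷ (Γ₂ ⊢ Δ₂) ∷ H) (principalʳ G)

transport : ∀ {S} → LNIF S → Transportable S
transport (mset d S≈) C = transport d (Cover-≈ S≈ C)
transport (id₁ G Γ Δ H p ts) = transportable-id₁ G Γ Δ H p ts
transport (id₂ G Γ₁ Δ₁ H Γ₂ Δ₂ F p ts) = transportable-id₂ G Γ₁ Δ₁ H Γ₂ Δ₂ F p ts
transport (⊥l G Γ Δ H) = transportable-⊥l G Γ Δ H
transport (∧l {G} d) = transportable-∧l G (transport d)
transport (∨r {G} d) = transportable-∨r G (transport d)
transport (∧r {G} d₁ d₂) = transportable-∧r G (transport d₁) (transport d₂)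
transport (∨l {G} d₁ d₂) = transportable-∨l G (transport d₁) (transport d₂)
transport (⊃r₁ {G} d) = transportable-⊃r₁ G (transport d)
transport (⊃l {G} d₁ d₂) = transportable-⊃l G (transport d₁) (transport d₂)
transport (lift {G} d) = transportable-lift G (transport d)
transport (∀l {G} a d) = transportable-∀l G a (transport d)
transport (∀r₁ {G} a a∉ d) = transportable-∀r₁ G a a∉ (transport d)
transport (∃l {G} a a∉ d) = transportable-∃l G a a∉ (transport d)
transport (∃r {G} a d) = transportable-∃r G a (transport d)
transport (⊃r₂ {G} d₁ d₂) = transportable-⊃r₂ G (transport d₁) (transport d₂)
transport (∀r₂ {G} a a∉ d₁ d₂) = transportable-∀r₂ G a a∉ (transport d₁) (transport d₂)

lemma16 : (G H : List Comp) (Γ Δ : List Formula) (A : Formula) →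
          ClosedS (G ++ (Γ ⊢ A ∷ A ∷ Δ) ∷ H) →
          LNIF (G ++ (Γ ⊢ A ∷ A ∷ Δ) ∷ H) →
          LNIF (G ++ (Γ ⊢ A ∷ Δ) ∷ H)
lemma16 G H Γ Δ A _ d = transport d (cover-weaken G (inj₁ , contract))
  where
  contract : ∀ {X} → X ∈ A ∷ A ∷ Δ → X ∈ A ∷ Δ ⊎ Impliedʳ (G ++ (Γ ⊢ A ∷ Δ) ∷ H) (length G) X
  contract (here refl) = inj₁ (here refl)
  contract (there x∈) = inj₁ x∈
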